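{- Let $P=([n],\preceq)$ be a poset and $w$ a weight on $\mathbb{F}_q$. For any $1\le r\le nM_w$, the number of $u\in\mathbb{F}_q^n$ with $w_{(P,w)}(u)=r$ is $$|A_r|=\sum_{i=1}^n\sum_{j=1}^i\ \sum_{I\in\mathcal{I}_j^i}\ \sum_{\substack{b\in PRT_{i-j}[r]\\ b\text{ has } j\text{ parts}}} q^{i-j}\prod_{s=1}^l|D_{t_s}|^{r_s}\binom{j-(r_1+\cdots+r_{s-1})}{r_s},$$ where, for a given $b=(b_1,\dots,b_j)$, $t_1,\dots,t_l$ are the distinct values among $b_1,\dots,b_j$ and $r_s$ is the number of parts equal to $t_s$ (with $r_0=0$).
   Context: A weight on $\mathbb{F}_q$ is a map $w:\mathbb{F}_q\to\mathbb{N}\cup\{0\}$ with $w(\alpha)=0$ iff $\alpha=0$, $w(-\alpha)=w(\alpha)$, $w(\alpha+\beta)\le w(\alpha)+w(\beta)$; $M_w=\max_\alpha w(\alpha)$; $D_r=\{\alpha\in\mathbb{F}_q:w(\alpha)=r\}$. Ideals of $P$ are down-closed subsets; $\langle A\rangle$ is the ideal generated by $A$; $\mathcal{I}_j^i$ is the set of ideals of cardinality $i$ with exactly $j$ maximal elements. For $u\in\mathbb{F}_q^n$, $supp(u)=\{i:u_i\ne0\}$, $I_u=\langle supp(u)\rangle$, $M_u$ the set of maximal elements of $I_u$, and the $(P,w)$-weight is $w_{(P,w)}(u)=\sum_{i\in M_u}w(u_i)+|I_u\setminus M_u|\,M_w$; $A_r=\{u:w_{(P,w)}(u)=r\}$.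 For integers $m\ge0$, $PRT_m[r]$ is the set of non-increasing sequences $(b_1,\dots,b_t)$ of positive integers with $b_1+\dots+b_t=r-mM_w$, each $b_s\le M_w$ and $1\le t\le n-m$. -}

module Defs where

open import Data.Nat using (ℕ; zero; suc; _+_; _*_; _∸_; _^_; _≤_; _<_; _⊔_)
open import Data.Nat.Combinatorics using (_C_)
open import Data.Fin using (Fin; toℕ)
open import Data.Fin as F using ()
open import Data.Bool using (Bool; true; false; if_then_else_; _∧_; not)
open import Data.List using (List; []; _∷_; map; foldr; allFin)
open import Data.Nat.ListAction using (sum)
open import Data.Product using (Σ; _×_; _,_; ∃)
open import Data.Vec.Functional using (Vector) renaming (_∷_ to _∷ᵛ_)
open import Relation.Nullary using (¬_; Dec; yes; no; does)
open import Relation.Binary using (Decidable; IsPartialOrder; IsDecPartialOrder)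
open import Relation.Binary.PropositionalEquality using (_≡_)
open import Algebra.Structures using (IsCommutativeRing)

record FiniteField (q : ℕ) : Set where
  field
    _+F_ _*F_ : Fin q → Fin q → Fin q
    -F_       : Fin q → Fin q
    0F 1F     : Fin q
    isCommutativeRing : IsCommutativeRing _≡_ _+F_ _*F_ -F_ 0F 1F
    0≢1       : ¬ (0F ≡ 1F)
    inverse   : ∀ x → ¬ (x ≡ 0F) → Σ (Fin q) λ y → x *F y ≡ 1F

record Weight {q : ℕ} (K : FiniteField q) : Set where
  open FiniteField K
  field
    w        : Fin q → ℕ
    w-zero   : ∀ α → w α ≡ 0 → α ≡ 0F
    w-zero′  : w 0F ≡ 0
    w-neg    : ∀ α → w (-F α) ≡ w α
    w-tri    : ∀ α β → w (α +F β) ≤ w α + w β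

-- Posets on [n] = Fin n (decidable, as every finite poset is)

record Poset (n : ℕ) : Set₁ where
  field
    _≼_ : Fin n → Fin n → Set
    isDecPartialOrder : IsDecPartialOrder _≡_ _≼_

countL : {A : Set} → List A → (A → Bool) → ℕ
countL xs p = sum (map (λ x → if p x then 1 else 0) xs)

-- sum over all functions Fin n → A, where xs lists all elements of A
sumFun : {A : Set} → List A → (n : ℕ) → ((Fin n → A) → ℕ) → ℕ
sumFun xs zero    f = f (λ ())
sumFun xs (suc n) f = sum (map (λ a → sumFun xs n (λ g → f (a ∷ᵛ g))) xs)

countFun : {A : Set} → List A → (n : ℕ) → ((Fin n → A) → Bool) → ℕ
countFun xs n p = sumFun xs n (λ g → if p g then 1 else 0)

anyFin : (n : ℕ) → (Fin n → Bool) → Bool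
anyFin n p = foldr (λ i b → p i Data.Bool.∨ b) false (allFin n)
  where import Data.Bool

allFinB : (n : ℕ) → (Fin n → Bool) → Bool
allFinB n p = foldr (λ i b → p i ∧ b) true (allFin n)

sumFin : (n : ℕ) → (Fin n → ℕ) → ℕ
sumFin n f = sum (map f (allFin n))

card : (n : ℕ) → (Fin n → Bool) → ℕ
card n S = countL (allFin n) S

-- sum over i = a .. b (inclusive), for a ≥ 1 used below
sumRange : ℕ → ℕ → (ℕ → ℕ) → ℕ
sumRange a b f = sum (map (λ k → f (a + k)) (Data.List.upTo (suc b ∸ a)))
  where import Data.List

module _ {q n : ℕ} (K : FiniteField q) (W : Weight K) (P : Poset n) where
  open FiniteField K
  open Weight W
  open Poset P
  open IsDecPartialOrder isDecPartialOrder using () renaming (_≟_ to _≟ₚ_; _≤?_ to _≼?_)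

  Mw : ℕ
  Mw = foldr (λ α m → w α ⊔ m) 0 (allFin q)

  Dcard : ℕ → ℕ
  Dcard r = countL (allFin q) (λ α → does (w α Data.Nat.≟ r))
    where import Data.Nat

  isZero : Fin q → Bool
  isZero α = does (α F.≟ 0F)

  supp : (Fin n → Fin q) → Fin n → Bool
  supp u i = not (isZero (u i))

  idealGen : (Fin n → Bool) → Fin n → Bool
  idealGen A j = anyFin n (λ i → A i ∧ does (j ≼? i))

  strictly : Fin n → Fin n → Bool
  strictly j k = does (j ≼? k) ∧ not (does (j ≟ₚ k))

  maximal : (Fin n → Bool) → Fin n → Bool
  maximal I j = I j ∧ not (anyFin n (λ k → I k ∧ strictly j k))

  isIdeal : (Fin n → Bool) → Bool
  isIdeal I = allFinB n (λ i → allFinB n (λ j →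
                if I i ∧ does (j ≼? i) then I j else true))

  I_ : (Fin n → Fin q) → Fin n → Bool
  I_ u = idealGen (supp u)

  M_ : (Fin n → Fin q) → Fin n → Bool
  M_ u = maximal (I_ u)

  wPw : (Fin n → Fin q) → ℕ
  wPw u = sumFin n (λ i → if M_ u i then w (u i) else 0)
        + card n (λ i → I_ u i ∧ not (M_ u i)) * Mw

  Acard : ℕ → ℕ
  Acard r = countFun (allFin q) n (λ u → does (wPw u Data.Nat.≟ r))
    where import Data.Nat

  idealCount : ℕ → ℕ → ℕ
  idealCount i j = countFun (true ∷ false ∷ []) n (λ I →
    isIdeal I ∧ does (card n I Data.Nat.≟ i) ∧ does (card n (maximal I) Data.Nat.≟ j))
    where import Data.Nat

runs : List ℕ → List (ℕ × ℕ)
runs [] = []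
runs (x ∷ xs) with runs xs
... | [] = (x , 1) ∷ []
... | (y , k) ∷ rs = if does (x Data.Nat.≟ y) then (y , suc k) ∷ rs else (x , 1) ∷ (y , k) ∷ rs
  where import Data.Nat

runProd : (ℕ → ℕ) → ℕ → ℕ → List (ℕ × ℕ) → ℕ
runProd D j acc [] = 1
runProd D j acc ((t , r) ∷ rs) = (D t ^ r) * ((j ∸ acc) C r) * runProd D j (acc + r) rs

toList : (j : ℕ) → (Fin j → ℕ) → List ℕ
toList j b = map b (allFin j)

nonIncreasing : (j : ℕ) → (Fin j → ℕ) → Bool
nonIncreasing j b = allFinB j (λ s → allFinB j (λ s′ →
  if does (toℕ s Data.Nat.≤? toℕ s′) then does (b s′ Data.Nat.≤? b s) else true))
  where import Data.Nat

-- b ∈ PRT_m[r] with exactly j parts (parts b_s ∈ {1..M}, non-increasing,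
-- Σ b_s = r - m·M, i.e. Σ b_s + m·M = r, and 1 ≤ j ≤ n - m)
inPRT : (n M m r j : ℕ) → (Fin j → ℕ) → Bool
inPRT n M m r j b =
  nonIncreasing j b
  ∧ allFinB j (λ s → does (1 Data.Nat.≤? b s) ∧ does (b s Data.Nat.≤? M))
  ∧ does (sum (toList j b) + m * M Data.Nat.≟ r)
  ∧ does (1 Data.Nat.≤? j) ∧ does (j + m Data.Nat.≤? n)
  where import Data.Nat

-- Σ_{b ∈ PRT_m[r], j parts} f(b): sequences enumerated with entries 1..M
sumPRT : (n M m r j : ℕ) → ((Fin j → ℕ) → ℕ) → ℕ
sumPRT n M m r j f = sumFun (allFin M) j (λ c →
  let b = λ s → suc (toℕ (c s)) in
  if inPRT n M m r j b then f b else 0)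

module _ {q n : ℕ} (K : FiniteField q) (W : Weight K) (P : Poset n) where

  RHS : ℕ → ℕ
  RHS r = sumRange 1 n (λ i → sumRange 1 i (λ j →
            idealCount K W P i j *
            sumPRT n (Mw K W P) (i ∸ j) r j (λ b →
              q ^ (i ∸ j) * runProd (Dcard K W P) j 0 (runs (toList j b)))))

module Submission where

-- Group the vectors u by the ideal I = I_u they generate. For an ideal I with maximal elements B and
-- A = I \ B, one has I_u = I exactly when u is nonzero on B, arbitrary on A and zero outside I, and
-- then w_(P,w)(u) = |A| M_w + Σ_{k ∈ B} w(u_k). So this fibre contributes q^|A| times the number of
-- |B|-tuples of nonzero elements of total weight r - |A| M_w, the coefficient of z^(r - |A| M_w) in
-- P(z)^|B| with P(z) = Σ_t |D_t| z^t. Expanding P^j by splitting off its highest term binomially, again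
-- and again, produces the sum over partitions b in the statement; grouping the ideals by cardinality i
-- and number j of maximal elements gives the formula. Only the empty ideal (the zero vector, of weight 0)
-- is absent from the right-hand side, whence r ≥ 1.

import Algebra.Properties.CommutativeSemigroup
import Algebra.Properties.Semiring.Sum
open import Data.Bool using (Bool; true; false; if_then_else_; _∧_; _∨_; not; T)
import Data.Bool as Bool
open import Data.Bool.Properties using (T-∧; T-∨; T-≡; ∧-identityʳ)
open import Data.Empty using (⊥-elim)
open import Data.Fin using (Fin; zero; suc; toℕ)
import Data.Fin as Fin
open import Data.Fin.Properties using (toℕ<n; toℕ-inject₁; toℕ-fromℕ)
open import Data.List using (List; []; _∷_; _++_; map; foldr; length; lookup; replicate; tabulate; applyUpTo; allFin)
open import Data.List.Properties using (foldr-map; map-cong; map-tabulate; map-applyUpTo)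
open import Data.List.Relation.Unary.All as All using (All; []; _∷_)
open import Data.Nat
open import Data.Nat.Combinatorics using (_C_; nCk+nC[k+1]≡[n+1]C[k+1])
open import Data.Nat.Combinatorics.Specification using (k>n⇒nCk≡0)
open import Data.Nat.ListAction using (sum)
open import Data.Nat.Properties
open import Data.Product using (∃; ∃₂; _×_; _,_; proj₁; proj₂)
open import Data.Sum using (inj₁; inj₂; [_,_]′)
open import Data.Unit using (tt)
open import Data.Vec.Functional using () renaming (_∷_ to _∷ᵛ_)
open import Function using (_∘_; id; _⇔_; mk⇔; Equivalence)
open import Relation.Binary using (IsDecPartialOrder)
open import Relation.Binary.PropositionalEquality
open import Relation.Nullary using (Dec; does; yes; no; ¬_)
open import Defs renaming (I_ to idealOf; M_ to maximalOf)

open Algebra.Properties.Semiring.Sum +-*-semiring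
  using (sum-syntax; sum-cong-≗; sum-replicate-zero; sum-init-last; ∑-distrib-+; ∑-comm; *-distribˡ-sum; *-distribʳ-sum)
module +-CS = Algebra.Properties.CommutativeSemigroup +-commutativeSemigroup
module *-CS = Algebra.Properties.CommutativeSemigroup *-commutativeSemigroup
open Equivalence using (to; from)
open ≡-Reasoning

𝟙 : Bool → ℕ
𝟙 b = if b then 1 else 0

T-does : ∀ {A : Set} (d : Dec A) → T (does d) ⇔ A
T-does (yes a) = mk⇔ (λ _ → a) (λ _ → tt)
T-does (no ¬a) = mk⇔ (λ ()) ¬a

T-not : ∀ {b} → T (not b) ⇔ (¬ T b)
T-not {true}  = mk⇔ (λ ()) (λ ¬t → ¬t tt)
T-not {false} = mk⇔ (λ _ ()) (λ _ → tt)

T⇔T⇒≡ : ∀ {a b} → (T a ⇔ T b) → a ≡ b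
T⇔T⇒≡ {false} {false} _ = refl
T⇔T⇒≡ {false} {true}  a⇔b = ⊥-elim (from a⇔b tt)
T⇔T⇒≡ {true}  {false} a⇔b = ⊥-elim (to a⇔b tt)
T⇔T⇒≡ {true}  {true}  _ = refl

foldr-allFin-suc : ∀ {B : Set} n (f : Fin (suc n) → B → B) e →
  foldr f e (allFin (suc n)) ≡ f zero (foldr (f ∘ suc) e (allFin n))
foldr-allFin-suc n f e = cong (f zero)
  (trans (cong (foldr f e) (sym (map-tabulate id suc))) (foldr-map f suc e (allFin n)))

T-allFinB : ∀ n {p : Fin n → Bool} → T (allFinB n p) ⇔ (∀ i → T (p i))
T-allFinB zero          = mk⇔ (λ _ ()) (λ _ → tt)
T-allFinB (suc n) {p} rewrite foldr-allFin-suc n (λ i b → p i ∧ b) true = mk⇔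
  (λ t → let (p0 , ps) = to T-∧ t in λ { zero → p0 ; (suc i) → to (T-allFinB n) ps i })
  (λ ps → from T-∧ (ps zero , from (T-allFinB n) (ps ∘ suc)))

T-anyFin : ∀ n {p : Fin n → Bool} → T (anyFin n p) ⇔ ∃ (λ i → T (p i))
T-anyFin zero          = mk⇔ (λ ()) (λ ())
T-anyFin (suc n) {p} rewrite foldr-allFin-suc n (λ i b → p i ∨ b) false = mk⇔
  (λ t → [ (λ p0 → zero , p0) , (λ ps → let (i , pi) = to (T-anyFin n) ps in suc i , pi) ]′ (to T-∨ t))
  (λ { (zero , p0) → from T-∨ (inj₁ p0) ; (suc i , pi) → from T-∨ (inj₂ (from (T-anyFin n) (i , pi))) })

T-→ᵇ : ∀ {a b} → T (if a then b else true) ⇔ (T a → T b)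
T-→ᵇ {true}  = mk⇔ (λ t _ → t) (λ f → f tt)
T-→ᵇ {false} = mk⇔ (λ _ ()) (λ _ → tt)

¬T⇒≡false : ∀ {b} → ¬ T b → b ≡ false
¬T⇒≡false {true}  ¬t = ⊥-elim (¬t tt)
¬T⇒≡false {false} _  = refl

if-∧ : ∀ a b (x : ℕ) → (if a ∧ b then x else 0) ≡ (if a then (if b then x else 0) else 0)
if-∧ true  b x = refl
if-∧ false b x = refl

if-∧≡𝟙-* : ∀ a b x → (if a ∧ b then x else 0) ≡ (if a then 𝟙 b * x else 0)
if-∧≡𝟙-* true  true  x = sym (+-identityʳ x)
if-∧≡𝟙-* true  false x = refl
if-∧≡𝟙-* false b     x = refl

∑< : ℕ → (ℕ → ℕ) → ℕ
∑< u f = ∑[ t < u ] f (toℕ t)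

∑-zero : ∀ n {f : Fin n → ℕ} → (∀ i → f i ≡ 0) → ∑[ i < n ] f i ≡ 0
∑-zero n f≡0 = trans (sum-cong-≗ {n} f≡0) (sum-replicate-zero n)

∑-const : ∀ n x → ∑[ i < n ] x ≡ n * x
∑-const zero    x = refl
∑-const (suc n) x = cong (x +_) (∑-const n x)

∑<-cong : ∀ u {f g : ℕ → ℕ} → (∀ t → t < u → f t ≡ g t) → ∑< u f ≡ ∑< u g
∑<-cong u f≡g = sum-cong-≗ {u} (λ t → f≡g (toℕ t) (toℕ<n t))

∑<-last : ∀ u (f : ℕ → ℕ) → ∑< (suc u) f ≡ ∑< u f + f u
∑<-last u f = trans (sum-init-last {u} (f ∘ toℕ))
  (cong₂ _+_ (sum-cong-≗ {u} (cong f ∘ toℕ-inject₁)) (cong f (toℕ-fromℕ u)))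

∑<-δ : ∀ u {y} (h : ℕ → ℕ) → y < u → ∑< u (λ t → 𝟙 (y ≡ᵇ t) * h t) ≡ h y
∑<-δ (suc u) {zero} h _ = begin
  h 0 + 0 + ∑< u (λ t → 0) ≡⟨ cong₂ _+_ (+-identityʳ (h 0)) (∑-zero u (λ _ → refl)) ⟩
  h 0 + 0                  ≡⟨ +-identityʳ (h 0) ⟩
  h 0                      ∎
∑<-δ (suc u) {suc y} h (s≤s y<u) = ∑<-δ u (h ∘ suc) y<u

∑<-restrict : ∀ u {v} (h : ℕ → ℕ) → v ≤ u → ∑< u (λ t → if t <ᵇ v then h t else 0) ≡ ∑< v h
∑<-restrict u {zero} h _ = ∑-zero u (λ _ → refl)
∑<-restrict (suc u) {suc v} h (s≤s v≤u) = cong (h 0 +_) (∑<-restrict u (h ∘ suc) v≤u)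

∑-δ : ∀ n (c : Fin n) x → ∑[ a < n ] (if does (a Fin.≟ c) then x else 0) ≡ x
∑-δ (suc n) zero x = trans (cong (x +_) (∑-zero n (λ _ → refl))) (+-identityʳ x)
∑-δ (suc n) (suc c) x = ∑-δ n c x

sum-map≡∑ : ∀ {A : Set} (xs : List A) (f : A → ℕ) → sum (map f xs) ≡ ∑[ i < length xs ] f (lookup xs i)
sum-map≡∑ []       f = refl
sum-map≡∑ (x ∷ xs) f = cong (f x +_) (sum-map≡∑ xs f)

sum-tabulate : ∀ n (f : Fin n → ℕ) → sum (tabulate f) ≡ ∑[ i < n ] f i
sum-tabulate zero    f = refl
sum-tabulate (suc n) f = cong (f zero +_) (sum-tabulate n (f ∘ suc))

sum-applyUpTo : ∀ n (f : ℕ → ℕ) → sum (applyUpTo f n) ≡ ∑< n f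
sum-applyUpTo zero    f = refl
sum-applyUpTo (suc n) f = cong (f 0 +_) (sum-applyUpTo n (f ∘ suc))

sumFin≡∑ : ∀ n (f : Fin n → ℕ) → sumFin n f ≡ ∑[ i < n ] f i
sumFin≡∑ n f = trans (cong sum (map-tabulate id f)) (sum-tabulate n f)

sumRange≡∑< : ∀ n (f : ℕ → ℕ) → sumRange 1 n f ≡ ∑< n (f ∘ suc)
sumRange≡∑< n f = trans (cong sum (map-applyUpTo id (f ∘ suc) n)) (sum-applyUpTo n (f ∘ suc))

module _ {A : Set} (xs : List A) where

  sumFun-cong : ∀ n {f g : (Fin n → A) → ℕ} → (∀ u → f u ≡ g u) → sumFun xs n f ≡ sumFun xs n g
  sumFun-cong zero    f≡g = f≡g _
  sumFun-cong (suc n) f≡g = cong sum (map-cong (λ a → sumFun-cong n (f≡g ∘ (a ∷ᵛ_))) xs)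

  ∑-sumFun : ∀ k n (f : Fin k → (Fin n → A) → ℕ) →
    ∑[ i < k ] sumFun xs n (f i) ≡ sumFun xs n (λ u → ∑[ i < k ] f i u)
  ∑-sumFun k zero    f = refl
  ∑-sumFun k (suc n) f = begin
    ∑[ i < k ] sum (map (λ a → sumFun xs n (f i ∘ (a ∷ᵛ_))) xs)
      ≡⟨ sum-cong-≗ {k} (λ i → sum-map≡∑ xs _) ⟩
    ∑[ i < k ] ∑[ j < length xs ] sumFun xs n (f i ∘ (lookup xs j ∷ᵛ_))
      ≡⟨ ∑-comm {k} {length xs} _ ⟩
    ∑[ j < length xs ] ∑[ i < k ] sumFun xs n (f i ∘ (lookup xs j ∷ᵛ_))
      ≡⟨ sum-cong-≗ {length xs} (λ j → ∑-sumFun k n (λ i → f i ∘ (lookup xs j ∷ᵛ_))) ⟩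
    ∑[ j < length xs ] sumFun xs n (λ u → ∑[ i < k ] f i (lookup xs j ∷ᵛ u))
      ≡⟨ sum-map≡∑ xs _ ⟨
    sumFun xs (suc n) (λ u → ∑[ i < k ] f i u) ∎

  sumFun-zero : ∀ n {f : (Fin n → A) → ℕ} → (∀ u → f u ≡ 0) → sumFun xs n f ≡ 0
  sumFun-zero n f≡0 = trans (sumFun-cong n f≡0) (sym (∑-sumFun 0 n (λ ())))

  sumFun-*ʳ : ∀ n (f : (Fin n → A) → ℕ) c → sumFun xs n (λ u → f u * c) ≡ sumFun xs n f * c
  sumFun-*ʳ zero    f c = refl
  sumFun-*ʳ (suc n) f c = begin
    sum (map (λ a → sumFun xs n (λ u → f (a ∷ᵛ u) * c)) xs)
      ≡⟨ cong sum (map-cong (λ a → sumFun-*ʳ n (f ∘ (a ∷ᵛ_)) c) xs) ⟩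
    sum (map (λ a → sumFun xs n (f ∘ (a ∷ᵛ_)) * c) xs)
      ≡⟨ sum-map≡∑ xs _ ⟩
    ∑[ j < length xs ] (sumFun xs n (f ∘ (lookup xs j ∷ᵛ_)) * c)
      ≡⟨ *-distribʳ-sum c (λ j → sumFun xs n (f ∘ (lookup xs j ∷ᵛ_))) ⟨
    ∑[ j < length xs ] sumFun xs n (f ∘ (lookup xs j ∷ᵛ_)) * c
      ≡⟨ cong (_* c) (sum-map≡∑ xs _) ⟨
    sumFun xs (suc n) f * c ∎

sumFun-comm : ∀ {A B : Set} (xs : List A) n (ys : List B) m (f : (Fin n → A) → (Fin m → B) → ℕ) →
  sumFun xs n (λ u → sumFun ys m (f u)) ≡ sumFun ys m (λ v → sumFun xs n (λ u → f u v))
sumFun-comm xs zero    ys m f = refl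
sumFun-comm xs (suc n) ys m f = begin
  sum (map (λ a → sumFun xs n (λ u → sumFun ys m (f (a ∷ᵛ u)))) xs)
    ≡⟨ cong sum (map-cong (λ a → sumFun-comm xs n ys m (f ∘ (a ∷ᵛ_))) xs) ⟩
  sum (map (λ a → sumFun ys m (λ v → sumFun xs n (λ u → f (a ∷ᵛ u) v))) xs)
    ≡⟨ sum-map≡∑ xs _ ⟩
  ∑[ j < length xs ] sumFun ys m (λ v → sumFun xs n (λ u → f (lookup xs j ∷ᵛ u) v))
    ≡⟨ ∑-sumFun ys (length xs) m _ ⟩
  sumFun ys m (λ v → ∑[ j < length xs ] sumFun xs n (λ u → f (lookup xs j ∷ᵛ u) v))
    ≡⟨ sumFun-cong ys m (λ v → sum-map≡∑ xs _) ⟨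
  sumFun ys m (λ v → sumFun xs (suc n) (λ u → f u v)) ∎

commute-if : ∀ {X : Set} (Φ : (X → ℕ) → ℕ) → Φ (λ _ → 0) ≡ 0 →
  ∀ c (h : X → ℕ) → Φ (λ x → if c then h x else 0) ≡ (if c then Φ h else 0)
commute-if Φ Φ0≡0 true  h = refl
commute-if Φ Φ0≡0 false h = Φ0≡0

-- If f lists the coefficients of a generating function F(z), then shift a f lists those of z^a F(z).
shift : ℕ → (ℕ → ℕ) → ℕ → ℕ
shift a f R = if a ≤ᵇ R then f (R ∸ a) else 0

shift-zero : ∀ a R → shift a (λ _ → 0) R ≡ 0
shift-zero a R with a ≤ᵇ R
... | true  = refl
... | false = refl

commute-shift : ∀ {X : Set} (Φ : (X → ℕ) → ℕ) → Φ (λ _ → 0) ≡ 0 →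
  ∀ a (h : X → ℕ → ℕ) R → Φ (λ x → shift a (h x) R) ≡ shift a (λ R′ → Φ (λ x → h x R′)) R
commute-shift Φ Φ0≡0 a h R = commute-if Φ Φ0≡0 (a ≤ᵇ R) (λ x → h x (R ∸ a))

shift-cong : ∀ a {f g : ℕ → ℕ} → (∀ R → f R ≡ g R) → ∀ R → shift a f R ≡ shift a g R
shift-cong a f≡g R with a ≤ᵇ R
... | true  = f≡g (R ∸ a)
... | false = refl

shift-*ˡ : ∀ a c (f : ℕ → ℕ) R → shift a (λ R′ → c * f R′) R ≡ c * shift a f R
shift-*ˡ a c f R with a ≤ᵇ R
... | true  = refl
... | false = sym (*-zeroʳ c)

shift-suc : ∀ a (f : ℕ → ℕ) R → shift (suc a) f (suc R) ≡ shift a f R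
shift-suc zero    f R = refl
shift-suc (suc a) f R = refl

shift-+ : ∀ a b (f : ℕ → ℕ) R → shift (a + b) f R ≡ shift a (shift b f) R
shift-+ zero    b f R       = refl
shift-+ (suc a) b f zero    = refl
shift-+ (suc a) b f (suc R) = begin
  shift (suc (a + b)) f (suc R) ≡⟨ shift-suc (a + b) f R ⟩
  shift (a + b) f R             ≡⟨ shift-+ a b f R ⟩
  shift a (shift b f) R         ≡⟨ shift-suc a (shift b f) R ⟨
  shift (suc a) (shift b f) (suc R) ∎

shift-comm : ∀ a b (f : ℕ → ℕ) R → shift a (shift b f) R ≡ shift b (shift a f) R
shift-comm a b f R = begin
  shift a (shift b f) R ≡⟨ shift-+ a b f R ⟨
  shift (a + b) f R     ≡⟨ cong (λ c → shift c f R) (+-comm a b) ⟩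
  shift (b + a) f R     ≡⟨ shift-+ b a f R ⟩
  shift b (shift a f) R ∎

𝟙-+≡shift : ∀ a s R → 𝟙 (a + s ≡ᵇ R) ≡ shift a (λ R′ → 𝟙 (s ≡ᵇ R′)) R
𝟙-+≡shift zero    s R       = refl
𝟙-+≡shift (suc a) s zero    = refl
𝟙-+≡shift (suc a) s (suc R) = trans (𝟙-+≡shift a s R) (sym (shift-suc a (λ R′ → 𝟙 (s ≡ᵇ R′)) R))

𝟙-+*≡*shift : ∀ a s R c x → 𝟙 (a + s ≡ᵇ R) * (c * x) ≡ c * shift a (λ R′ → 𝟙 (s ≡ᵇ R′) * x) R
𝟙-+*≡*shift zero    s R       c x = *-CS.x∙yz≈y∙xz (𝟙 (s ≡ᵇ R)) c x
𝟙-+*≡*shift (suc a) s zero    c x = sym (*-zeroʳ c)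
𝟙-+*≡*shift (suc a) s (suc R) c x =
  trans (𝟙-+*≡*shift a s R c x) (cong (c *_) (sym (shift-suc a (λ R′ → 𝟙 (s ≡ᵇ R′) * x) R)))

𝟙-mono : ∀ {a b} → (T a → T b) → 𝟙 a ≤ 𝟙 b
𝟙-mono {false}         _   = z≤n
𝟙-mono {true}  {true}  _   = ≤-refl
𝟙-mono {true}  {false} a⇒b = ⊥-elim (a⇒b tt)

count : ∀ n → (Fin n → Bool) → ℕ
count n f = ∑[ k < n ] 𝟙 (f k)

count-mono : ∀ n {f g : Fin n → Bool} → (∀ k → T (f k) → T (g k)) → count n f ≤ count n g
count-mono zero    f⊆g = z≤n
count-mono (suc n) f⊆g = +-mono-≤ (𝟙-mono (f⊆g zero)) (count-mono n (f⊆g ∘ suc))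

count-mono-< : ∀ n {f g : Fin n → Bool} → (∀ k → T (f k) → T (g k)) → ∀ y → T (g y) → ¬ T (f y) → count n f < count n g
count-mono-< (suc n) {f} {g} f⊆g zero gy ¬fy with f zero | g zero
... | false | true  = s≤s (count-mono n (f⊆g ∘ suc))
... | true  | _     = ⊥-elim (¬fy tt)
... | false | false = ⊥-elim gy
count-mono-< (suc n) f⊆g (suc y) gy ¬fy = +-mono-≤-< (𝟙-mono (f⊆g zero)) (count-mono-< n (f⊆g ∘ suc) y gy ¬fy)

count≤n : ∀ n (f : Fin n → Bool) → count n f ≤ n
count≤n n f = ≤-trans (count-mono n {f} {λ _ → true} (λ _ _ → tt)) (≤-reflexive (trans (∑-const n 1) (*-identityʳ n)))

count-pos : ∀ n (f : Fin n → Bool) → 1 ≤ count n f ⇔ ∃ (λ k → T (f k))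
count-pos n f = mk⇔ (witness n f) (λ (k , fk) → positive n f k fk)
  where
  positive : ∀ n (f : Fin n → Bool) k → T (f k) → 1 ≤ count n f
  positive (suc n) f zero fk with f zero
  ... | true  = s≤s z≤n
  ... | false = ⊥-elim fk
  positive (suc n) f (suc k) fk = ≤-trans (positive n (f ∘ suc) k fk) (m≤n+m _ (𝟙 (f zero)))
  witness : ∀ n (f : Fin n → Bool) → 1 ≤ count n f → ∃ (λ k → T (f k))
  witness (suc n) f 1≤c with f zero in f₀
  ... | true  = zero , from T-≡ f₀
  ... | false = let (k , fk) = witness n (f ∘ suc) 1≤c in suc k , fk

count-split : ∀ n (f g : Fin n → Bool) → (∀ k → T (g k) → T (f k)) → count n (λ k → f k ∧ not (g k)) + count n g ≡ count n f
count-split zero    f g g⊆f = refl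
count-split (suc n) f g g⊆f = begin
  𝟙 (f zero ∧ not (g zero)) + count n (λ k → f (suc k) ∧ not (g (suc k))) + (𝟙 (g zero) + count n (g ∘ suc))
    ≡⟨ +-CS.interchange (𝟙 (f zero ∧ not (g zero))) _ (𝟙 (g zero)) _ ⟩
  (𝟙 (f zero ∧ not (g zero)) + 𝟙 (g zero)) + (count n (λ k → f (suc k) ∧ not (g (suc k))) + count n (g ∘ suc))
    ≡⟨ cong₂ _+_ (first (f zero) (g zero) (g⊆f zero)) (count-split n (f ∘ suc) (g ∘ suc) (g⊆f ∘ suc)) ⟩
  count (suc n) f ∎
  where
  first : ∀ a b → (T b → T a) → 𝟙 (a ∧ not b) + 𝟙 b ≡ 𝟙 a
  first true  true  _   = refl
  first true  false _   = refl
  first false false _   = refl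
  first false true  b⇒a = ⊥-elim (b⇒a tt)

sameSet : ∀ n → (Fin n → Bool) → (Fin n → Bool) → Bool
sameSet n I J = allFinB n (λ k → does (I k Bool.≟ J k))

T-sameSet : ∀ n I J → T (sameSet n I J) ⇔ (∀ k → I k ≡ J k)
T-sameSet n I J = mk⇔
  (λ t k → to (T-does (I k Bool.≟ J k)) (to (T-allFinB n) t k))
  (λ I≗J → from (T-allFinB n) (λ k → from (T-does (I k Bool.≟ J k)) (I≗J k)))

bools : List Bool
bools = true ∷ false ∷ []

sumFun-sameSet-δ : ∀ n (J : Fin n → Bool) x →
  sumFun bools n (λ I → if sameSet n I J then x else 0) ≡ x
sumFun-sameSet-δ zero    J x = refl
sumFun-sameSet-δ (suc n) J x = begin
  first-entry true + (first-entry false + 0)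
    ≡⟨ cong₂ (λ y z → y + (z + 0)) (pick true) (pick false) ⟩
  (if does (true Bool.≟ J zero) then x else 0) + ((if does (false Bool.≟ J zero) then x else 0) + 0)
    ≡⟨ one-match (J zero) ⟩
  x ∎
  where
  first-entry : Bool → ℕ
  first-entry b = sumFun bools n (λ I → if sameSet (suc n) (b ∷ᵛ I) J then x else 0)
  pick : ∀ b → first-entry b ≡ (if does (b Bool.≟ J zero) then x else 0)
  pick b = begin
    first-entry b
      ≡⟨ sumFun-cong bools n (λ I → trans
           (cong (λ c → if c then x else 0) (foldr-allFin-suc n (λ k c → does ((b ∷ᵛ I) k Bool.≟ J k) ∧ c) true))
           (if-∧ (does (b Bool.≟ J zero)) _ x)) ⟩
    sumFun bools n (λ I → if does (b Bool.≟ J zero) then (if sameSet n I (J ∘ suc) then x else 0) else 0)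
      ≡⟨ commute-if (sumFun bools n) (sumFun-zero bools n (λ _ → refl)) (does (b Bool.≟ J zero)) _ ⟩
    (if does (b Bool.≟ J zero) then sumFun bools n (λ I → if sameSet n I (J ∘ suc) then x else 0) else 0)
      ≡⟨ cong (λ y → if does (b Bool.≟ J zero) then y else 0) (sumFun-sameSet-δ n (J ∘ suc) x) ⟩
    (if does (b Bool.≟ J zero) then x else 0) ∎
  one-match : ∀ c → (if does (true Bool.≟ c) then x else 0) + ((if does (false Bool.≟ c) then x else 0) + 0) ≡ x
  one-match true  = +-identityʳ x
  one-match false = +-identityʳ x

∑<-δ₂ : ∀ n i₀ j₀ (Y : ℕ → ℕ → ℕ) → i₀ < n → j₀ ≤ i₀ →
  ∑< n (λ i → ∑< (suc i) (λ j → 𝟙 ((i₀ ≡ᵇ i) ∧ (j₀ ≡ᵇ j)) * Y i j)) ≡ Y i₀ j₀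
∑<-δ₂ n i₀ j₀ Y i₀<n j₀≤i₀ = begin
  ∑< n (λ i → ∑< (suc i) (λ j → 𝟙 ((i₀ ≡ᵇ i) ∧ (j₀ ≡ᵇ j)) * Y i j))
    ≡⟨ sum-cong-≗ {n} (λ i → trans
         (sum-cong-≗ {suc (toℕ i)} (λ j → 𝟙-∧-* (i₀ ≡ᵇ toℕ i) (j₀ ≡ᵇ toℕ j) (Y (toℕ i) (toℕ j))))
         (sym (*-distribˡ-sum {suc (toℕ i)} (𝟙 (i₀ ≡ᵇ toℕ i)) (λ j → 𝟙 (j₀ ≡ᵇ toℕ j) * Y (toℕ i) (toℕ j))))) ⟩
  ∑< n (λ i → 𝟙 (i₀ ≡ᵇ i) * ∑< (suc i) (λ j → 𝟙 (j₀ ≡ᵇ j) * Y i j))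
    ≡⟨ ∑<-δ n (λ i → ∑< (suc i) (λ j → 𝟙 (j₀ ≡ᵇ j) * Y i j)) i₀<n ⟩
  ∑< (suc i₀) (λ j → 𝟙 (j₀ ≡ᵇ j) * Y i₀ j)
    ≡⟨ ∑<-δ (suc i₀) (Y i₀) (s≤s j₀≤i₀) ⟩
  Y i₀ j₀ ∎
  where
  𝟙-∧-* : ∀ a b y → 𝟙 (a ∧ b) * y ≡ 𝟙 a * (𝟙 b * y)
  𝟙-∧-* true  b y = sym (+-identityʳ _)
  𝟙-∧-* false b y = refl

module _ (D : ℕ → ℕ) where

  -- Multiplication of a coefficient list by the polynomial P_v(z) = D 1 z + D 2 z² + ⋯ + D v zᵛ.
  mulP : ℕ → (ℕ → ℕ) → ℕ → ℕ
  mulP v f R = ∑< v (λ t → D (suc t) * shift (suc t) f R)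

  mulP-last : ∀ v f R → mulP (suc v) f R ≡ mulP v f R + D (suc v) * shift (suc v) f R
  mulP-last v f R = ∑<-last v (λ t → D (suc t) * shift (suc t) f R)

  *-mulP : ∀ v c f R → c * mulP v f R ≡ mulP v (λ R′ → c * f R′) R
  *-mulP v c f R = begin
    c * mulP v f R
      ≡⟨ *-distribˡ-sum {v} c (λ t → D (suc (toℕ t)) * shift (suc (toℕ t)) f R) ⟩
    ∑< v (λ t → c * (D (suc t) * shift (suc t) f R))
      ≡⟨ sum-cong-≗ {v} (λ t → *-CS.x∙yz≈y∙xz c (D (suc (toℕ t))) (shift (suc (toℕ t)) f R)) ⟩
    ∑< v (λ t → D (suc t) * (c * shift (suc t) f R))
      ≡⟨ sum-cong-≗ {v} (λ t → cong (D (suc (toℕ t)) *_) (shift-*ˡ (suc (toℕ t)) c f R)) ⟨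
    mulP v (λ R′ → c * f R′) R ∎

  shift-mulP : ∀ a v f R → shift a (mulP v f) R ≡ mulP v (shift a f) R
  shift-mulP a v f R = begin
    shift a (mulP v f) R
      ≡⟨ commute-shift (∑< v) (sum-replicate-zero v) a (λ t R′ → D (suc t) * shift (suc t) f R′) R ⟨
    ∑< v (λ t → shift a (λ R′ → D (suc t) * shift (suc t) f R′) R)
      ≡⟨ sum-cong-≗ {v} (λ t → shift-*ˡ a (D (suc (toℕ t))) (shift (suc (toℕ t)) f) R) ⟩
    ∑< v (λ t → D (suc t) * shift a (shift (suc t) f) R)
      ≡⟨ sum-cong-≗ {v} (λ t → cong (D (suc (toℕ t)) *_) (shift-comm a (suc (toℕ t)) f R)) ⟩
    mulP v (shift a f) R ∎

  ∑<-mulP : ∀ n v (f : ℕ → ℕ → ℕ) R → ∑< n (λ k → mulP v (f k) R) ≡ mulP v (λ R′ → ∑< n (λ k → f k R′)) R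
  ∑<-mulP n v f R = begin
    ∑< n (λ k → mulP v (f k) R)
      ≡⟨ ∑-comm {n} {v} (λ k t → D (suc (toℕ t)) * shift (suc (toℕ t)) (f (toℕ k)) R) ⟩
    ∑< v (λ t → ∑< n (λ k → D (suc t) * shift (suc t) (f k) R))
      ≡⟨ sum-cong-≗ {v} (λ t → *-distribˡ-sum {n} (D (suc (toℕ t))) (λ k → shift (suc (toℕ t)) (f (toℕ k)) R)) ⟨
    ∑< v (λ t → D (suc t) * ∑< n (λ k → shift (suc t) (f k) R))
      ≡⟨ sum-cong-≗ {v} (λ t → cong (D (suc (toℕ t)) *_)
           (commute-shift (∑< n) (sum-replicate-zero n) (suc (toℕ t)) f R)) ⟩
    mulP v (λ R′ → ∑< n (λ k → f k R′)) R ∎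

  -- coeffPow v j R is the coefficient of z^R in P_v(z)^j, expanded by the binomial theorem in the top term D v zᵛ.
  coeffPow : ℕ → ℕ → ℕ → ℕ
  coeffPow zero    zero    R = 𝟙 (R ≡ᵇ 0)
  coeffPow zero    (suc j) R = 0
  coeffPow (suc v) j       R =
    ∑< (suc j) (λ k → D (suc v) ^ k * (j C k) * shift (k * suc v) (coeffPow v (j ∸ k)) R)

  coeffPow-zero : ∀ v R → coeffPow v 0 R ≡ 𝟙 (R ≡ᵇ 0)
  coeffPow-zero zero    R = refl
  coeffPow-zero (suc v) R = trans (+-identityʳ _) (trans (*-identityˡ _) (coeffPow-zero v R))

  coeffPow-suc : ∀ v j R → coeffPow v (suc j) R ≡ mulP v (coeffPow v j) R
  coeffPow-suc zero    j R = refl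
  coeffPow-suc (suc v) j R = begin
    coeffPow V (suc j) R
      ≡⟨ pascal ⟩
    ∑< (suc j) lower + ∑< (suc j) upper
      ≡⟨ cong₂ _+_ lower-sum upper-sum ⟩
    mulP v (coeffPow V j) R + d * shift V (coeffPow V j) R
      ≡⟨ mulP-last v (coeffPow V j) R ⟨
    mulP V (coeffPow V j) R ∎
    where
    V = suc v
    d = D V
    term : ℕ → (ℕ → ℕ) → ℕ → ℕ
    term k f R′ = d ^ k * (j C k) * shift (k * V) f R′
    lower upper : ℕ → ℕ
    lower k = term k (coeffPow v (suc j ∸ k)) R
    upper k = d ^ suc k * (j C k) * shift (suc k * V) (coeffPow v (j ∸ k)) R

    pascal : coeffPow V (suc j) R ≡ ∑< (suc j) lower + ∑< (suc j) upper
    pascal = begin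
      lower 0 + ∑< (suc j) (λ k → d ^ suc k * (suc j C suc k) * shift (suc k * V) (coeffPow v (j ∸ k)) R)
        ≡⟨ cong (lower 0 +_) (sum-cong-≗ {suc j} (λ k → split (toℕ k))) ⟩
      lower 0 + ∑< (suc j) (λ k → upper k + lower (suc k))
        ≡⟨ cong (lower 0 +_) (∑-distrib-+ {suc j} (upper ∘ toℕ) (lower ∘ suc ∘ toℕ)) ⟩
      lower 0 + (∑< (suc j) upper + ∑< (suc j) (lower ∘ suc))
        ≡⟨ +-CS.x∙yz≈y∙xz (lower 0) (∑< (suc j) upper) (∑< (suc j) (lower ∘ suc)) ⟩
      ∑< (suc j) upper + ∑< (suc (suc j)) lower
        ≡⟨ cong (∑< (suc j) upper +_) (∑<-last (suc j) lower) ⟩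
      ∑< (suc j) upper + (∑< (suc j) lower + lower (suc j))
        ≡⟨ cong (λ c → ∑< (suc j) upper + (∑< (suc j) lower + c)) lower-top≡0 ⟩
      ∑< (suc j) upper + (∑< (suc j) lower + 0)
        ≡⟨ trans (cong (∑< (suc j) upper +_) (+-identityʳ (∑< (suc j) lower))) (+-comm (∑< (suc j) upper) (∑< (suc j) lower)) ⟩
      ∑< (suc j) lower + ∑< (suc j) upper ∎
      where
      lower-top≡0 : lower (suc j) ≡ 0
      lower-top≡0 = trans (cong (λ c → d ^ suc j * c * X) (k>n⇒nCk≡0 (n<1+n j))) (cong (_* X) (*-zeroʳ (d ^ suc j)))
        where
        X = shift (suc j * V) (coeffPow v (j ∸ j)) R
      split : ∀ k → d ^ suc k * (suc j C suc k) * shift (suc k * V) (coeffPow v (j ∸ k)) R ≡ upper k + lower (suc k)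
      split k = begin
        d ^ suc k * (suc j C suc k) * X
          ≡⟨ cong (λ c → d ^ suc k * c * X) (nCk+nC[k+1]≡[n+1]C[k+1] j k) ⟨
        d ^ suc k * ((j C k) + (j C suc k)) * X
          ≡⟨ cong (_* X) (*-distribˡ-+ (d ^ suc k) (j C k) (j C suc k)) ⟩
        (d ^ suc k * (j C k) + d ^ suc k * (j C suc k)) * X
          ≡⟨ *-distribʳ-+ X (d ^ suc k * (j C k)) (d ^ suc k * (j C suc k)) ⟩
        upper k + lower (suc k) ∎
        where
        X = shift (suc k * V) (coeffPow v (j ∸ k)) R

    lower-sum : ∑< (suc j) lower ≡ mulP v (coeffPow V j) R
    lower-sum = begin
      ∑< (suc j) lower
        ≡⟨ ∑<-cong (suc j) (λ k k≤j → cong (λ i → term k (coeffPow v i) R) (+-∸-assoc 1 (≤-pred k≤j))) ⟩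
      ∑< (suc j) (λ k → term k (coeffPow v (suc (j ∸ k))) R)
        ≡⟨ sum-cong-≗ {suc j} (λ k → lower-term (toℕ k)) ⟩
      ∑< (suc j) (λ k → mulP v (term k (coeffPow v (j ∸ k))) R)
        ≡⟨ ∑<-mulP (suc j) v (λ k → term k (coeffPow v (j ∸ k))) R ⟩
      mulP v (coeffPow V j) R ∎
      where
      lower-term : ∀ k → term k (coeffPow v (suc (j ∸ k))) R ≡ mulP v (term k (coeffPow v (j ∸ k))) R
      lower-term k = begin
        d ^ k * (j C k) * shift (k * V) (coeffPow v (suc (j ∸ k))) R
          ≡⟨ cong (d ^ k * (j C k) *_) (shift-cong (k * V) (coeffPow-suc v (j ∸ k)) R) ⟩
        d ^ k * (j C k) * shift (k * V) (mulP v (coeffPow v (j ∸ k))) R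
          ≡⟨ cong (d ^ k * (j C k) *_) (shift-mulP (k * V) v (coeffPow v (j ∸ k)) R) ⟩
        d ^ k * (j C k) * mulP v (shift (k * V) (coeffPow v (j ∸ k))) R
          ≡⟨ *-mulP v (d ^ k * (j C k)) (shift (k * V) (coeffPow v (j ∸ k))) R ⟩
        mulP v (term k (coeffPow v (j ∸ k))) R ∎

    upper-sum : ∑< (suc j) upper ≡ d * shift V (coeffPow V j) R
    upper-sum = begin
      ∑< (suc j) upper
        ≡⟨ sum-cong-≗ {suc j} (λ k → upper-term (toℕ k)) ⟩
      ∑< (suc j) (λ k → d * shift V (term k (coeffPow v (j ∸ k))) R)
        ≡⟨ *-distribˡ-sum {suc j} d (λ k → shift V (term (toℕ k) (coeffPow v (j ∸ toℕ k))) R) ⟨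
      d * ∑< (suc j) (λ k → shift V (term k (coeffPow v (j ∸ k))) R)
        ≡⟨ cong (d *_) (commute-shift (∑< (suc j)) (sum-replicate-zero (suc j)) V (λ k → term k (coeffPow v (j ∸ k))) R) ⟩
      d * shift V (coeffPow V j) R ∎
      where
      upper-term : ∀ k → upper k ≡ d * shift V (term k (coeffPow v (j ∸ k))) R
      upper-term k = begin
        d * d ^ k * (j C k) * shift (V + k * V) (coeffPow v (j ∸ k)) R
          ≡⟨ cong (d * d ^ k * (j C k) *_) (shift-+ V (k * V) (coeffPow v (j ∸ k)) R) ⟩
        d * d ^ k * (j C k) * shift V X R
          ≡⟨ trans (cong (_* shift V X R) (*-assoc d (d ^ k) (j C k))) (*-assoc d (d ^ k * (j C k)) (shift V X R)) ⟩
        d * (d ^ k * (j C k) * shift V X R)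
          ≡⟨ cong (d *_) (shift-*ˡ V (d ^ k * (j C k)) X R) ⟨
        d * shift V (term k (coeffPow v (j ∸ k))) R ∎
        where
        X = shift (k * V) (coeffPow v (j ∸ k))

-- sumNonIncr j v F sums F over the non-increasing lists of length j with entries in [1, v].
sumNonIncr : ℕ → ℕ → (List ℕ → ℕ) → ℕ
sumNonIncr zero    v F = F []
sumNonIncr (suc j) v F = ∑< v (λ t → sumNonIncr j (suc t) (λ L → F (suc t ∷ L)))

sumNonIncr-cong : ∀ j v {F G : List ℕ → ℕ} → (∀ L → All (_≤ v) L → F L ≡ G L) → sumNonIncr j v F ≡ sumNonIncr j v G
sumNonIncr-cong zero    v F≡G = F≡G [] []
sumNonIncr-cong (suc j) v F≡G = ∑<-cong v (λ t t<v → sumNonIncr-cong j (suc t)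
  (λ L L≤t → F≡G (suc t ∷ L) (t<v ∷ All.map (λ x≤t → ≤-trans x≤t t<v) L≤t)))

sumNonIncr-zero : ∀ j v → sumNonIncr j v (λ _ → 0) ≡ 0
sumNonIncr-zero zero    v = refl
sumNonIncr-zero (suc j) v = ∑-zero v (λ t → sumNonIncr-zero j (suc (toℕ t)))

*-sumNonIncr : ∀ j v c F → c * sumNonIncr j v F ≡ sumNonIncr j v (λ L → c * F L)
*-sumNonIncr zero    v c F = refl
*-sumNonIncr (suc j) v c F = trans
  (*-distribˡ-sum {v} c (λ t → sumNonIncr j (suc (toℕ t)) (λ L → F (suc (toℕ t) ∷ L))))
  (sum-cong-≗ {v} (λ t → *-sumNonIncr j (suc (toℕ t)) c (λ L → F (suc (toℕ t) ∷ L))))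

sumNonIncr-split : ∀ j v F →
  sumNonIncr j (suc v) F ≡ ∑< (suc j) (λ k → sumNonIncr (j ∸ k) v (λ L → F (replicate k (suc v) ++ L)))
sumNonIncr-split zero    v F = sym (+-identityʳ (F []))
sumNonIncr-split (suc j) v F = begin
  ∑< (suc v) rest                      ≡⟨ ∑<-last v rest ⟩
  sumNonIncr (suc j) v F + rest v      ≡⟨ cong (sumNonIncr (suc j) v F +_) (sumNonIncr-split j v (λ L → F (suc v ∷ L))) ⟩
  sumNonIncr (suc j) v F + ∑< (suc j) (λ k → sumNonIncr (j ∸ k) v (λ L → F (suc v ∷ replicate k (suc v) ++ L))) ∎
  where
  rest : ℕ → ℕ
  rest t = sumNonIncr j (suc t) (λ L → F (suc t ∷ L))

pushRun : ℕ → List (ℕ × ℕ) → List (ℕ × ℕ)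
pushRun x []             = (x , 1) ∷ []
pushRun x ((y , k) ∷ rs) = if x ≡ᵇ y then (y , suc k) ∷ rs else (x , 1) ∷ (y , k) ∷ rs

runs-∷ : ∀ x xs → runs (x ∷ xs) ≡ pushRun x (runs xs)
runs-∷ x xs with runs xs
... | []          = refl
... | (y , k) ∷ rs = refl

runs-head : ∀ x xs → ∃₂ λ k rs → runs (x ∷ xs) ≡ (x , k) ∷ rs
runs-head x xs with runs xs
... | []          = 1 , [] , refl
... | (y , k) ∷ rs with x ≡ᵇ y in x≡ᵇy
...   | true  rewrite ≡ᵇ⇒≡ x y (subst T (sym x≡ᵇy) _) = suc k , rs , refl
...   | false = 1 , (y , k) ∷ rs , refl

runs-replicate : ∀ k v L → All (_≤ v) L → runs (replicate (suc k) (suc v) ++ L) ≡ (suc v , suc k) ∷ runs L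
runs-replicate zero v [] _ = refl
runs-replicate zero v (y ∷ L) (y≤v ∷ _) with runs-head y L
... | k , rs , runs-yL = begin
  runs (suc v ∷ y ∷ L)           ≡⟨ runs-∷ (suc v) (y ∷ L) ⟩
  pushRun (suc v) (runs (y ∷ L)) ≡⟨ cong (pushRun (suc v)) runs-yL ⟩
  pushRun (suc v) ((y , k) ∷ rs)
    ≡⟨ cong (λ b → if b then (y , suc k) ∷ rs else (suc v , 1) ∷ (y , k) ∷ rs)
            (¬T⇒≡false (<⇒≢ (s≤s y≤v) ∘ sym ∘ ≡ᵇ⇒≡ (suc v) y)) ⟩
  (suc v , 1) ∷ (y , k) ∷ rs     ≡⟨ cong ((suc v , 1) ∷_) runs-yL ⟨
  (suc v , 1) ∷ runs (y ∷ L)     ∎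
runs-replicate (suc k) v L L≤v = begin
  runs (suc v ∷ replicate (suc k) (suc v) ++ L)           ≡⟨ runs-∷ (suc v) (replicate (suc k) (suc v) ++ L) ⟩
  pushRun (suc v) (runs (replicate (suc k) (suc v) ++ L)) ≡⟨ cong (pushRun (suc v)) (runs-replicate k v L L≤v) ⟩
  pushRun (suc v) ((suc v , suc k) ∷ runs L)
    ≡⟨ cong (λ b → if b then (suc v , suc (suc k)) ∷ runs L else (suc v , 1) ∷ (suc v , suc k) ∷ runs L)
            (to T-≡ (≡⇒≡ᵇ v v refl)) ⟩
  (suc v , suc (suc k)) ∷ runs L                         ∎

sum-replicate-++ : ∀ k v L → sum (replicate k v ++ L) ≡ k * v + sum L
sum-replicate-++ zero    v L = refl
sum-replicate-++ (suc k) v L = trans (cong (v +_) (sum-replicate-++ k v L)) (sym (+-assoc v (k * v) (sum L)))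

module _ (D : ℕ → ℕ) where

  runProd-offset : ∀ j k acc rs → runProd D j (k + acc) rs ≡ runProd D (j ∸ k) acc rs
  runProd-offset j k acc []             = refl
  runProd-offset j k acc ((t , r) ∷ rs) = cong₂ (λ a b → D t ^ r * (a C r) * b)
    (sym (∸-+-assoc j k acc))
    (trans (cong (λ a → runProd D j a rs) (+-assoc k acc r)) (runProd-offset j k (acc + r) rs))

  runProd-replicate : ∀ j k v L → All (_≤ v) L →
    runProd D j 0 (runs (replicate k (suc v) ++ L)) ≡ D (suc v) ^ k * (j C k) * runProd D (j ∸ k) 0 (runs L)
  runProd-replicate j zero    v L _   = sym (+-identityʳ (runProd D j 0 (runs L)))
  runProd-replicate j (suc k) v L L≤v = begin
    runProd D j 0 (runs (replicate (suc k) (suc v) ++ L))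
      ≡⟨ cong (runProd D j 0) (runs-replicate k v L L≤v) ⟩
    D (suc v) ^ suc k * (j C suc k) * runProd D j (suc k) (runs L)
      ≡⟨ cong (λ a → D (suc v) ^ suc k * (j C suc k) * runProd D j a (runs L)) (+-identityʳ (suc k)) ⟨
    D (suc v) ^ suc k * (j C suc k) * runProd D j (suc k + 0) (runs L)
      ≡⟨ cong (D (suc v) ^ suc k * (j C suc k) *_) (runProd-offset j (suc k) 0 (runs L)) ⟩
    D (suc v) ^ suc k * (j C suc k) * runProd D (j ∸ suc k) 0 (runs L) ∎

  -- The summand of the paper's formula at the partition L into j parts, restricted to partitions of R.
  partitionTerm : ℕ → ℕ → List ℕ → ℕ
  partitionTerm j R L = 𝟙 (sum L ≡ᵇ R) * runProd D j 0 (runs L)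

  partitionTerm-replicate : ∀ j R k v L → All (_≤ v) L →
    partitionTerm j R (replicate k (suc v) ++ L)
      ≡ D (suc v) ^ k * (j C k) * shift (k * suc v) (λ R′ → partitionTerm (j ∸ k) R′ L) R
  partitionTerm-replicate j R k v L L≤v = begin
    𝟙 (sum (replicate k (suc v) ++ L) ≡ᵇ R) * runProd D j 0 (runs (replicate k (suc v) ++ L))
      ≡⟨ cong₂ _*_ (cong (λ s → 𝟙 (s ≡ᵇ R)) (sum-replicate-++ k (suc v) L)) (runProd-replicate j k v L L≤v) ⟩
    𝟙 (k * suc v + sum L ≡ᵇ R) * (D (suc v) ^ k * (j C k) * runProd D (j ∸ k) 0 (runs L))
      ≡⟨ 𝟙-+*≡*shift (k * suc v) (sum L) R (D (suc v) ^ k * (j C k)) (runProd D (j ∸ k) 0 (runs L)) ⟩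
    D (suc v) ^ k * (j C k) * shift (k * suc v) (λ R′ → partitionTerm (j ∸ k) R′ L) R ∎

  sumNonIncr≡coeffPow : ∀ v j R → sumNonIncr j v (partitionTerm j R) ≡ coeffPow D v j R
  sumNonIncr≡coeffPow zero    zero    zero    = refl
  sumNonIncr≡coeffPow zero    zero    (suc R) = refl
  sumNonIncr≡coeffPow zero    (suc j) R       = refl
  sumNonIncr≡coeffPow (suc v) j       R       = begin
    sumNonIncr j (suc v) (partitionTerm j R)
      ≡⟨ sumNonIncr-split j v (partitionTerm j R) ⟩
    ∑< (suc j) (λ k → sumNonIncr (j ∸ k) v (λ L → partitionTerm j R (replicate k (suc v) ++ L)))
      ≡⟨ sum-cong-≗ {suc j} (λ k → top-parts (toℕ k)) ⟩
    coeffPow D (suc v) j R ∎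
    where
    top-parts : ∀ k → sumNonIncr (j ∸ k) v (λ L → partitionTerm j R (replicate k (suc v) ++ L))
                      ≡ D (suc v) ^ k * (j C k) * shift (k * suc v) (coeffPow D v (j ∸ k)) R
    top-parts k = begin
      sumNonIncr (j ∸ k) v (λ L → partitionTerm j R (replicate k (suc v) ++ L))
        ≡⟨ sumNonIncr-cong (j ∸ k) v (partitionTerm-replicate j R k v) ⟩
      sumNonIncr (j ∸ k) v (λ L → c * shift (k * suc v) (λ R′ → partitionTerm (j ∸ k) R′ L) R)
        ≡⟨ *-sumNonIncr (j ∸ k) v c _ ⟨
      c * sumNonIncr (j ∸ k) v (λ L → shift (k * suc v) (λ R′ → partitionTerm (j ∸ k) R′ L) R)
        ≡⟨ cong (c *_) (commute-shift (sumNonIncr (j ∸ k) v) (sumNonIncr-zero (j ∸ k) v) (k * suc v)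
                          (λ L R′ → partitionTerm (j ∸ k) R′ L) R) ⟩
      c * shift (k * suc v) (λ R′ → sumNonIncr (j ∸ k) v (partitionTerm (j ∸ k) R′)) R
        ≡⟨ cong (c *_) (shift-cong (k * suc v) (sumNonIncr≡coeffPow v (j ∸ k)) R) ⟩
      c * shift (k * suc v) (coeffPow D v (j ∸ k)) R ∎
      where
      c = D (suc v) ^ k * (j C k)

NonIncreasing : ∀ j → (Fin j → ℕ) → Set
NonIncreasing j b = ∀ s s′ → toℕ s ≤ toℕ s′ → b s′ ≤ b s

T-nonIncreasing : ∀ j b → T (nonIncreasing j b) ⇔ NonIncreasing j b
T-nonIncreasing j b = mk⇔
  (λ t s s′ s≤s′ → ≤ᵇ⇒≤ (b s′) (b s)
     (to T-→ᵇ (to (T-allFinB j) (to (T-allFinB j) t s) s′) (≤⇒≤ᵇ s≤s′)))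
  (λ ni → from (T-allFinB j) λ s → from (T-allFinB j) λ s′ →
     from T-→ᵇ (λ t → ≤⇒≤ᵇ (ni s s′ (≤ᵇ⇒≤ (toℕ s) (toℕ s′) t))))

descBounded : ∀ j → (Fin j → ℕ) → ℕ → Bool
descBounded j b v = nonIncreasing j b ∧ allFinB j (λ s → b s ≤ᵇ v)

DescBounded : ∀ j → (Fin j → ℕ) → ℕ → Set
DescBounded j b v = NonIncreasing j b × (∀ s → b s ≤ v)

T-descBounded : ∀ j b v → T (descBounded j b v) ⇔ DescBounded j b v
T-descBounded j b v = mk⇔
  (λ t → let (ni , bd) = to T-∧ t in
     to (T-nonIncreasing j b) ni , λ s → ≤ᵇ⇒≤ (b s) v (to (T-allFinB j) bd s))
  (λ (ni , bd) → from T-∧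
     (from (T-nonIncreasing j b) ni , from (T-allFinB j) (λ s → ≤⇒≤ᵇ (bd s))))

DescBounded-suc : ∀ j (b : Fin (suc j) → ℕ) v → DescBounded (suc j) b v ⇔ (b zero ≤ v × DescBounded j (b ∘ suc) (b zero))
DescBounded-suc j b v = mk⇔
  (λ (ni , bd) → bd zero , (λ s s′ s≤s′ → ni (suc s) (suc s′) (s≤s s≤s′)) , (λ s → ni zero (suc s) z≤n))
  (λ (b₀≤v , ni , bd) → ni′ ni bd , λ { zero → b₀≤v ; (suc s) → ≤-trans (bd s) b₀≤v })
  where
  ni′ : NonIncreasing j (b ∘ suc) → (∀ s → b (suc s) ≤ b zero) → NonIncreasing (suc j) b
  ni′ ni bd zero    zero     _         = ≤-refl
  ni′ ni bd zero    (suc s′) _         = bd s′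
  ni′ ni bd (suc s) (suc s′) (s≤s s≤s′) = ni s s′ s≤s′

descBounded-suc : ∀ j (b : Fin (suc j) → ℕ) v → descBounded (suc j) b v ≡ ((b zero ≤ᵇ v) ∧ descBounded j (b ∘ suc) (b zero))
descBounded-suc j b v = T⇔T⇒≡ (mk⇔
  (λ t → let (b₀≤v , db) = to (DescBounded-suc j b v) (to (T-descBounded (suc j) b v) t) in
     from T-∧ (≤⇒≤ᵇ b₀≤v , from (T-descBounded j (b ∘ suc) (b zero)) db))
  (λ t → let (b₀≤v , db) = to T-∧ t in
     from (T-descBounded (suc j) b v) (from (DescBounded-suc j b v)
       (≤ᵇ⇒≤ (b zero) v b₀≤v , to (T-descBounded j (b ∘ suc) (b zero)) db))))

toList-suc : ∀ j (b : Fin (suc j) → ℕ) → toList (suc j) b ≡ b zero ∷ toList j (b ∘ suc)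
toList-suc j b = cong (b zero ∷_) (trans (map-tabulate suc b) (sym (map-tabulate id (b ∘ suc))))

-- Sequences in [1, M] are encoded as suc ∘ toℕ ∘ c for c : Fin j → Fin M, as in sumPRT.
sumFun-descBounded : ∀ M j v (F : List ℕ → ℕ) → v ≤ M →
  sumFun (allFin M) j (λ c → if descBounded j (suc ∘ toℕ ∘ c) v then F (toList j (suc ∘ toℕ ∘ c)) else 0)
    ≡ sumNonIncr j v F
sumFun-descBounded M zero    v F v≤M = refl
sumFun-descBounded M (suc j) v F v≤M = begin
  sumFin M (λ a → sumFun (allFin M) j (λ g → body (a ∷ᵛ g)))
    ≡⟨ sumFin≡∑ M _ ⟩
  ∑[ a < M ] sumFun (allFin M) j (λ g → body (a ∷ᵛ g))
    ≡⟨ sum-cong-≗ {M} first-entry ⟩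
  ∑< M (λ t → if t <ᵇ v then sumNonIncr j (suc t) (λ L → F (suc t ∷ L)) else 0)
    ≡⟨ ∑<-restrict M (λ t → sumNonIncr j (suc t) (λ L → F (suc t ∷ L))) v≤M ⟩
  sumNonIncr (suc j) v F ∎
  where
  body : (Fin (suc j) → Fin M) → ℕ
  body c = if descBounded (suc j) (suc ∘ toℕ ∘ c) v then F (toList (suc j) (suc ∘ toℕ ∘ c)) else 0
  first-entry : ∀ a → sumFun (allFin M) j (λ g → body (a ∷ᵛ g))
                        ≡ (if toℕ a <ᵇ v then sumNonIncr j (suc (toℕ a)) (λ L → F (suc (toℕ a) ∷ L)) else 0)
  first-entry a = begin
    sumFun (allFin M) j (λ g → body (a ∷ᵛ g))
      ≡⟨ sumFun-cong (allFin M) j (λ g → trans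
           (cong₂ (λ b L → if b then F L else 0) (descBounded-suc j (suc ∘ toℕ ∘ (a ∷ᵛ g)) v) (toList-suc j (suc ∘ toℕ ∘ (a ∷ᵛ g))))
           (if-∧ (toℕ a <ᵇ v) _ _)) ⟩
    sumFun (allFin M) j (λ g → if toℕ a <ᵇ v then rest g else 0)
      ≡⟨ commute-if (sumFun (allFin M) j) (sumFun-zero (allFin M) j (λ _ → refl)) (toℕ a <ᵇ v) rest ⟩
    (if toℕ a <ᵇ v then sumFun (allFin M) j rest else 0)
      ≡⟨ cong (λ x → if toℕ a <ᵇ v then x else 0) (sumFun-descBounded M j (suc (toℕ a)) (λ L → F (suc (toℕ a) ∷ L)) (toℕ<n a)) ⟩
    (if toℕ a <ᵇ v then sumNonIncr j (suc (toℕ a)) (λ L → F (suc (toℕ a) ∷ L)) else 0) ∎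
    where
    rest : (Fin j → Fin M) → ℕ
    rest g = if descBounded j (suc ∘ toℕ ∘ g) (suc (toℕ a)) then F (suc (toℕ a) ∷ toList j (suc ∘ toℕ ∘ g)) else 0

inPRT-encoded : ∀ n M m r J (c : Fin J → Fin M) → 1 ≤ J → J + m ≤ n →
  inPRT n M m r J (suc ∘ toℕ ∘ c) ≡ descBounded J (suc ∘ toℕ ∘ c) M ∧ (sum (toList J (suc ∘ toℕ ∘ c)) + m * M ≡ᵇ r)
inPRT-encoded n M m r J c 1≤J J+m≤n
  rewrite to T-≡ (from (T-allFinB J) (λ s → ≤⇒≤ᵇ (toℕ<n (c s))))
        | to T-≡ (≤⇒≤ᵇ 1≤J)
        | to T-≡ (≤⇒≤ᵇ J+m≤n)
        = trans (cong (N ∧_) (∧-identityʳ E)) (cong (_∧ E) (sym (∧-identityʳ N)))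
  where
  N = nonIncreasing J (suc ∘ toℕ ∘ c)
  E = sum (toList J (suc ∘ toℕ ∘ c)) + m * M ≡ᵇ r

sumPRT≡shift-coeffPow : ∀ (D : ℕ → ℕ) x n M m r J → 1 ≤ J → J + m ≤ n →
  sumPRT n M m r J (λ b → x * runProd D J 0 (runs (toList J b))) ≡ x * shift (m * M) (coeffPow D M J) r
sumPRT≡shift-coeffPow D x n M m r J 1≤J J+m≤n = begin
  sumPRT n M m r J (λ b → x * runProd D J 0 (runs (toList J b)))
    ≡⟨ sumFun-cong (allFin M) J (λ c → trans
         (cong (λ b → if b then x * ρ (toList J (suc ∘ toℕ ∘ c)) else 0) (inPRT-encoded n M m r J c 1≤J J+m≤n))
         (if-∧≡𝟙-* (descBounded J (suc ∘ toℕ ∘ c) M) _ _)) ⟩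
  sumFun (allFin M) J (λ c → if descBounded J (suc ∘ toℕ ∘ c) M then F (toList J (suc ∘ toℕ ∘ c)) else 0)
    ≡⟨ sumFun-descBounded M J M F ≤-refl ⟩
  sumNonIncr J M F
    ≡⟨ sumNonIncr-cong J M (λ L _ → F≡ L) ⟩
  sumNonIncr J M (λ L → x * shift (m * M) (λ R′ → partitionTerm D J R′ L) r)
    ≡⟨ *-sumNonIncr J M x _ ⟨
  x * sumNonIncr J M (λ L → shift (m * M) (λ R′ → partitionTerm D J R′ L) r)
    ≡⟨ cong (x *_) (commute-shift (sumNonIncr J M) (sumNonIncr-zero J M) (m * M) (λ L R′ → partitionTerm D J R′ L) r) ⟩
  x * shift (m * M) (λ R′ → sumNonIncr J M (partitionTerm D J R′)) r
    ≡⟨ cong (x *_) (shift-cong (m * M) (sumNonIncr≡coeffPow D M J) r) ⟩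
  x * shift (m * M) (coeffPow D M J) r ∎
  where
  ρ : List ℕ → ℕ
  ρ L = runProd D J 0 (runs L)
  F : List ℕ → ℕ
  F L = 𝟙 (sum L + m * M ≡ᵇ r) * (x * ρ L)
  F≡ : ∀ L → F L ≡ x * shift (m * M) (λ R′ → partitionTerm D J R′ L) r
  F≡ L = trans (cong (λ s → 𝟙 (s ≡ᵇ r) * (x * ρ L)) (+-comm (sum L) (m * M))) (𝟙-+*≡*shift (m * M) (sum L) r x (ρ L))

module _ {q n : ℕ} (K : FiniteField q) (W : Weight K) (P : Poset n) where
  open FiniteField K
  open Weight W

  M : ℕ
  M = Mw K W P

  D : ℕ → ℕ
  D = Dcard K W P

  w≤Mw : ∀ α → w α ≤ M
  w≤Mw = w≤foldr q id
    where
    w≤foldr : ∀ m (g : Fin m → Fin q) i → w (g i) ≤ foldr (λ α m → w α ⊔ m) 0 (tabulate g)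
    w≤foldr (suc m) g zero    = m≤m⊔n _ _
    w≤foldr (suc m) g (suc i) = ≤-trans (w≤foldr m (g ∘ suc) i) (m≤n⊔m (w (g zero)) _)

  isZero⇒≡0 : ∀ α → isZero K W P α ≡ true → α ≡ 0F
  isZero⇒≡0 α isZ with α Fin.≟ 0F
  ... | yes α≡0 = α≡0

  isZero⇒≢0 : ∀ α → isZero K W P α ≡ false → α ≢ 0F
  isZero⇒≢0 α ¬isZ with α Fin.≟ 0F
  ... | no α≢0 = α≢0

  ∑-nonzero-shift : ∀ f R → ∑[ α < q ] (if isZero K W P α then 0 else shift (w α) f R) ≡ mulP D M f R
  ∑-nonzero-shift f R = begin
    ∑[ α < q ] (if isZero K W P α then 0 else shift (w α) f R)
      ≡⟨ sum-cong-≗ {q} by-weight ⟩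
    ∑[ α < q ] ∑< M (λ t → 𝟙 (w α ≡ᵇ suc t) * shift (suc t) f R)
      ≡⟨ ∑-comm {q} {M} _ ⟩
    ∑< M (λ t → ∑[ α < q ] (𝟙 (w α ≡ᵇ suc t) * shift (suc t) f R))
      ≡⟨ sum-cong-≗ {M} (λ t → count-weight (suc (toℕ t)) (shift (suc (toℕ t)) f R)) ⟩
    mulP D M f R ∎
    where
    count-weight : ∀ r x → ∑[ α < q ] (𝟙 (w α ≡ᵇ r) * x) ≡ D r * x
    count-weight r x = begin
      ∑[ α < q ] (𝟙 (w α ≡ᵇ r) * x) ≡⟨ *-distribʳ-sum {q} x (λ α → 𝟙 (w α ≡ᵇ r)) ⟨
      ∑[ α < q ] 𝟙 (w α ≡ᵇ r) * x   ≡⟨ cong (_* x) (sumFin≡∑ q (λ α → 𝟙 (w α ≡ᵇ r))) ⟨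
      D r * x                       ∎
    by-weight : ∀ α → (if isZero K W P α then 0 else shift (w α) f R)
                      ≡ ∑< M (λ t → 𝟙 (w α ≡ᵇ suc t) * shift (suc t) f R)
    by-weight α with isZero K W P α in α≟0
    ... | true  = sym (∑-zero M (λ t → cong (λ x → 𝟙 (x ≡ᵇ suc (toℕ t)) * shift (suc (toℕ t)) f R) w≡0))
      where
      w≡0 : w α ≡ 0
      w≡0 = trans (cong w (isZero⇒≡0 α α≟0)) w-zero′
    ... | false with w α in wα≡ | w≤Mw α
    ...   | zero  | _   = ⊥-elim (isZero⇒≢0 α α≟0 (w-zero α wα≡))
    ...   | suc y | y<M = sym (∑<-δ M (λ t → shift (suc t) f R) y<M)

  data Slot : Set where
    free nonzero vanishing : Slot

  allowed : Slot → Fin q → Bool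
  allowed free      α = true
  allowed nonzero   α = not (isZero K W P α)
  allowed vanishing α = isZero K W P α

  slotWeight : Slot → Fin q → ℕ
  slotWeight free      α = 0
  slotWeight nonzero   α = w α
  slotWeight vanishing α = 0

  isFree isNonzero : Slot → Bool
  isFree free = true
  isFree _    = false
  isNonzero nonzero = true
  isNonzero _       = false

  fits : ∀ m → (Fin m → Slot) → (Fin m → Fin q) → Bool
  fits m κ u = allFinB m (λ k → allowed (κ k) (u k))

  count-by-slots : ∀ m (κ : Fin m → Slot) R →
    sumFun (allFin q) m (λ u → if fits m κ u then 𝟙 (∑[ k < m ] slotWeight (κ k) (u k) ≡ᵇ R) else 0)
      ≡ q ^ ∑[ k < m ] 𝟙 (isFree (κ k)) * coeffPow D M (∑[ k < m ] 𝟙 (isNonzero (κ k))) R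
  count-by-slots zero    κ zero    = sym (trans (*-identityˡ _) (coeffPow-zero D M 0))
  count-by-slots zero    κ (suc R) = sym (trans (*-identityˡ _) (coeffPow-zero D M (suc R)))
  count-by-slots (suc m) κ R = begin
    sumFin q (λ α → sumFun (allFin q) m (λ g → whole (α ∷ᵛ g)))
      ≡⟨ sumFin≡∑ q _ ⟩
    ∑[ α < q ] sumFun (allFin q) m (λ g → whole (α ∷ᵛ g))
      ≡⟨ sum-cong-≗ {q} first-coordinate ⟩
    ∑[ α < q ] (if allowed (κ zero) α then shift (slotWeight (κ zero) α) counted R else 0)
      ≡⟨ by-slot (κ zero) ⟩
    q ^ (𝟙 (isFree (κ zero)) + #free) * coeffPow D M (𝟙 (isNonzero (κ zero)) + #nonzero) R ∎
    where
    #free #nonzero : ℕ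
    #free    = ∑[ k < m ] 𝟙 (isFree (κ (suc k)))
    #nonzero = ∑[ k < m ] 𝟙 (isNonzero (κ (suc k)))
    whole : (Fin (suc m) → Fin q) → ℕ
    whole u = if fits (suc m) κ u then 𝟙 (∑[ k < suc m ] slotWeight (κ k) (u k) ≡ᵇ R) else 0
    restWeight : (Fin m → Fin q) → ℕ
    restWeight g = ∑[ k < m ] slotWeight (κ (suc k)) (g k)
    rest : (Fin m → Fin q) → ℕ → ℕ
    rest g R′ = if fits m (κ ∘ suc) g then 𝟙 (restWeight g ≡ᵇ R′) else 0
    counted : ℕ → ℕ
    counted R′ = q ^ #free * coeffPow D M #nonzero R′

    first-coordinate : ∀ α → sumFun (allFin q) m (λ g → whole (α ∷ᵛ g))
                             ≡ (if allowed (κ zero) α then shift (slotWeight (κ zero) α) counted R else 0)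
    first-coordinate α = begin
      sumFun (allFin q) m (λ g → whole (α ∷ᵛ g))
        ≡⟨ sumFun-cong (allFin q) m (λ g → trans
             (cong (λ b → if b then 𝟙 (a + restWeight g ≡ᵇ R) else 0)
                   (foldr-allFin-suc m (λ k b → allowed (κ k) ((α ∷ᵛ g) k) ∧ b) true))
             (if-∧ (allowed (κ zero) α) (fits m (κ ∘ suc) g) _)) ⟩
      sumFun (allFin q) m (λ g → if allowed (κ zero) α then (if fits m (κ ∘ suc) g then 𝟙 (a + restWeight g ≡ᵇ R) else 0) else 0)
        ≡⟨ sumFun-cong (allFin q) m (λ g → cong (λ x → if allowed (κ zero) α then x else 0)
             (trans (cong (λ x → if fits m (κ ∘ suc) g then x else 0) (𝟙-+≡shift a _ R))
                    (sym (commute-if (λ f → shift a f R) (shift-zero a R) (fits m (κ ∘ suc) g)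
                            (λ R′ → 𝟙 (restWeight g ≡ᵇ R′)))))) ⟩
      sumFun (allFin q) m (λ g → if allowed (κ zero) α then shift a (rest g) R else 0)
        ≡⟨ commute-if (sumFun (allFin q) m) (sumFun-zero (allFin q) m (λ _ → refl)) (allowed (κ zero) α) _ ⟩
      (if allowed (κ zero) α then sumFun (allFin q) m (λ g → shift a (rest g) R) else 0)
        ≡⟨ cong (λ x → if allowed (κ zero) α then x else 0) (begin
             sumFun (allFin q) m (λ g → shift a (rest g) R)
               ≡⟨ commute-shift (sumFun (allFin q) m) (sumFun-zero (allFin q) m (λ _ → refl)) a rest R ⟩
             shift a (λ R′ → sumFun (allFin q) m (λ g → rest g R′)) R
               ≡⟨ shift-cong a (count-by-slots m (κ ∘ suc)) R ⟩
             shift a counted R ∎) ⟩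
      (if allowed (κ zero) α then shift a counted R else 0) ∎
      where
      a = slotWeight (κ zero) α

    by-slot : ∀ s → ∑[ α < q ] (if allowed s α then shift (slotWeight s α) counted R else 0)
                    ≡ q ^ (𝟙 (isFree s) + #free) * coeffPow D M (𝟙 (isNonzero s) + #nonzero) R
    by-slot free = trans (∑-const q (counted R)) (sym (*-assoc q (q ^ #free) _))
    by-slot nonzero = begin
      ∑[ α < q ] (if not (isZero K W P α) then shift (w α) counted R else 0)
        ≡⟨ sum-cong-≗ {q} (λ α → nonzero-term (isZero K W P α) (w α)) ⟩
      ∑[ α < q ] (q ^ #free * (if isZero K W P α then 0 else shift (w α) (coeffPow D M #nonzero) R))
        ≡⟨ *-distribˡ-sum {q} (q ^ #free) _ ⟨
      q ^ #free * ∑[ α < q ] (if isZero K W P α then 0 else shift (w α) (coeffPow D M #nonzero) R)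
        ≡⟨ cong (q ^ #free *_) (trans (∑-nonzero-shift (coeffPow D M #nonzero) R) (sym (coeffPow-suc D M #nonzero R))) ⟩
      q ^ #free * coeffPow D M (suc #nonzero) R ∎
      where
      nonzero-term : ∀ b a → (if not b then shift a counted R else 0)
                             ≡ q ^ #free * (if b then 0 else shift a (coeffPow D M #nonzero) R)
      nonzero-term true  a = sym (*-zeroʳ (q ^ #free))
      nonzero-term false a = shift-*ˡ a (q ^ #free) (coeffPow D M #nonzero) R
    by-slot vanishing = ∑-δ q 0F (counted R)

  open Poset P
  private module ≼ = IsDecPartialOrder isDecPartialOrder

  T-strictly : ∀ j k → T (strictly K W P j k) ⇔ (j ≼ k × j ≢ k)
  T-strictly j k = mk⇔
    (λ t → let (j≼k , j≉k) = to T-∧ t in to (T-does (j ≼.≤? k)) j≼k , to T-not j≉k ∘ from (T-does (j ≼.≟ k)))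
    (λ (j≼k , j≢k) → from T-∧ (from (T-does (j ≼.≤? k)) j≼k , from T-not (j≢k ∘ to (T-does (j ≼.≟ k)))))

  IsMaximal : (Fin n → Bool) → Fin n → Set
  IsMaximal I m = T (I m) × (∀ k → T (I k) → m ≼ k → m ≡ k)

  T-maximal : ∀ I m → T (maximal K W P I m) ⇔ IsMaximal I m
  T-maximal I m = mk⇔
    (λ t → let (Im , ¬above) = to T-∧ t in Im , λ k Ik m≼k → top (to T-not ¬above) k Ik m≼k)
    (λ (Im , top) → from T-∧ (Im , from T-not λ above →
       let (k , Ik∧m≺k) = to (T-anyFin n) above ; (Ik , m≺k) = to T-∧ Ik∧m≺k ; (m≼k , m≢k) = to (T-strictly m k) m≺k in
       m≢k (top k Ik m≼k)))
    where
    top : ¬ T (anyFin n (λ k → I k ∧ strictly K W P m k)) → ∀ k → T (I k) → m ≼ k → m ≡ k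
    top ¬above k Ik m≼k with m ≼.≟ k
    ... | yes m≡k = m≡k
    ... | no  m≢k = ⊥-elim (¬above (from (T-anyFin n) (k , from T-∧ (Ik , from (T-strictly m k) (m≼k , m≢k)))))

  IsDownClosed : (Fin n → Bool) → Set
  IsDownClosed I = ∀ i j → T (I i) → j ≼ i → T (I j)

  T-isIdeal : ∀ I → T (isIdeal K W P I) ⇔ IsDownClosed I
  T-isIdeal I = mk⇔
    (λ t i j Ii j≼i → to T-→ᵇ (to (T-allFinB n) (to (T-allFinB n) t i) j) (from T-∧ (Ii , from (T-does (j ≼.≤? i)) j≼i)))
    (λ down → from (T-allFinB n) λ i → from (T-allFinB n) λ j → from T-→ᵇ λ t →
       let (Ii , j≼i) = to T-∧ t in down i j Ii (to (T-does (j ≼.≤? i)) j≼i))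

  T-idealOf : ∀ u k → T (idealOf K W P u k) ⇔ ∃ (λ i → T (supp K W P u i) × k ≼ i)
  T-idealOf u k = mk⇔
    (λ t → let (i , t′) = to (T-anyFin n) t ; (ui , k≼i) = to T-∧ t′ in i , ui , to (T-does (k ≼.≤? i)) k≼i)
    (λ (i , ui , k≼i) → from (T-anyFin n) (i , from T-∧ (ui , from (T-does (k ≼.≤? i)) k≼i)))

  idealOf-downClosed : ∀ u → IsDownClosed (idealOf K W P u)
  idealOf-downClosed u i j ui j≼i =
    let (i′ , ui′ , i≼i′) = to (T-idealOf u i) ui in from (T-idealOf u j) (i′ , ui′ , ≼.trans j≼i i≼i′)

  maximal-idealOf⇒supp : ∀ u m → IsMaximal (idealOf K W P u) m → T (supp K W P u m)
  maximal-idealOf⇒supp u m (um , top) =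
    let (i , ui , m≼i) = to (T-idealOf u m) um in
    subst (T ∘ supp K W P u) (sym (top i (from (T-idealOf u i) (i , ui , ≼.refl)) m≼i)) ui

  maximal-above : ∀ I k → T (I k) → ∃ (λ m → IsMaximal I m × k ≼ m)
  maximal-above I k Ik = climb (suc (#above k)) k Ik ≤-refl
    where
    #above : Fin n → ℕ
    #above k = count n (λ x → I x ∧ does (k ≼.≤? x))
    -- Moving strictly up inside I strictly decreases the number of elements of I above the current one.
    climb : ∀ fuel k → T (I k) → #above k < fuel → ∃ (λ m → IsMaximal I m × k ≼ m)
    climb (suc fuel) k Ik #above<fuel with anyFin n (λ k′ → I k′ ∧ strictly K W P k k′) in higher
    ... | false = k , to (T-maximal I k) (from T-∧ (Ik , subst (T ∘ not) (sym higher) tt)) , ≼.refl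
    ... | true  =
      let (k′ , t) = to (T-anyFin n) (from T-≡ higher)
          (Ik′ , k≺k′) = to T-∧ t
          (k≼k′ , k≢k′) = to (T-strictly k k′) k≺k′
          fewer : #above k′ < #above k
          fewer = count-mono-< n
            (λ x t′ → let (Ix , k′≼x) = to T-∧ t′ in
                      from T-∧ (Ix , from (T-does (k ≼.≤? x)) (≼.trans k≼k′ (to (T-does (k′ ≼.≤? x)) k′≼x))))
            k (from T-∧ (Ik , from (T-does (k ≼.≤? k)) ≼.refl))
            (λ t′ → k≢k′ (≼.antisym k≼k′ (to (T-does (k′ ≼.≤? k)) (proj₂ (to T-∧ t′)))))
          (m , max-m , k′≼m) = climb fuel k′ Ik′ (<-≤-trans fewer (≤-pred #above<fuel))
      in m , max-m , ≼.trans k≼k′ k′≼m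

  slotOf : Bool → Bool → Slot
  slotOf true  _     = nonzero
  slotOf false true  = free
  slotOf false false = vanishing

  slot : (Fin n → Bool) → Fin n → Slot
  slot I k = slotOf (maximal K W P I k) (I k)

  slotOf-cases : ∀ {m a} (C : Slot → Set) → (m ≡ true → C nonzero) → (m ≡ false → a ≡ true → C free) →
    (m ≡ false → a ≡ false → C vanishing) → C (slotOf m a)
  slotOf-cases {true}          C c₁ c₂ c₃ = c₁ refl
  slotOf-cases {false} {true}  C c₁ c₂ c₃ = c₂ refl refl
  slotOf-cases {false} {false} C c₁ c₂ c₃ = c₃ refl refl

  IsMaximal-cong : ∀ {I J} → (∀ k → I k ≡ J k) → ∀ m → IsMaximal I m → IsMaximal J m
  IsMaximal-cong I≗J m (Im , top) = subst T (I≗J m) Im , λ k Jk → top k (subst T (sym (I≗J k)) Jk)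

  module _ (I : Fin n → Bool) (I-down : IsDownClosed I) (u : Fin n → Fin q) where

    sameSet⇒fits : (∀ k → I k ≡ idealOf K W P u k) → ∀ k → T (allowed (slot I k) (u k))
    sameSet⇒fits I≗ k = slotOf-cases (λ s → T (allowed s (u k)))
      (λ max-k → maximal-idealOf⇒supp u k (IsMaximal-cong I≗ k (to (T-maximal I k) (from T-≡ max-k))))
      (λ _ _ → tt)
      (λ _ I-k → ¬T-not⇒T λ uk≢0 → subst T (trans (sym (I≗ k)) I-k) (from (T-idealOf u k) (k , uk≢0 , ≼.refl)))
      where
      ¬T-not⇒T : ∀ {b} → ¬ T (not b) → T b
      ¬T-not⇒T {true}  _  = tt
      ¬T-not⇒T {false} ¬t = ¬t tt

    fits⇒sameSet : (∀ k → T (allowed (slot I k) (u k))) → ∀ k → I k ≡ idealOf K W P u k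
    fits⇒sameSet fits-u k = T⇔T⇒≡ (mk⇔ below-maximal in-support)
      where
      below-maximal : T (I k) → T (idealOf K W P u k)
      below-maximal Ik =
        let (m , max-m , k≼m) = maximal-above I k Ik
            slot-m : slot I m ≡ nonzero
            slot-m = cong (λ b → slotOf b (I m)) (to T-≡ (from (T-maximal I m) max-m))
        in from (T-idealOf u k) (m , subst (λ s → T (allowed s (u m))) slot-m (fits-u m) , k≼m)
      support⊆I : ∀ i → T (supp K W P u i) → T (I i)
      support⊆I i ui≢0 with I i in I-i
      ... | true  = tt
      ... | false =
        let slot-i : slot I i ≡ vanishing
            slot-i = cong₂ slotOf (¬T⇒≡false (λ max-i → subst T I-i (proj₁ (to (T-maximal I i) max-i)))) I-i
        in to T-not ui≢0 (subst (λ s → T (allowed s (u i))) slot-i (fits-u i))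
      in-support : T (idealOf K W P u k) → T (I k)
      in-support uk = let (i , ui≢0 , k≼i) = to (T-idealOf u k) uk in I-down i k (support⊆I i ui≢0) k≼i

    sameSet≡fits : sameSet n I (idealOf K W P u) ≡ fits n (slot I) u
    sameSet≡fits = T⇔T⇒≡ (mk⇔
      (λ t → from (T-allFinB n) (sameSet⇒fits (to (T-sameSet n I _) t)))
      (λ t → from (T-sameSet n I _) (fits⇒sameSet (to (T-allFinB n) t))))

  slotWeight-slotOf : ∀ m a α → slotWeight (slotOf m a) α ≡ (if m then w α else 0)
  slotWeight-slotOf true  a     α = refl
  slotWeight-slotOf false true  α = refl
  slotWeight-slotOf false false α = refl

  isFree-slotOf : ∀ m a → isFree (slotOf m a) ≡ a ∧ not m
  isFree-slotOf true  true  = refl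
  isFree-slotOf true  false = refl
  isFree-slotOf false true  = refl
  isFree-slotOf false false = refl

  isNonzero-slotOf : ∀ m a → isNonzero (slotOf m a) ≡ m
  isNonzero-slotOf true  a     = refl
  isNonzero-slotOf false true  = refl
  isNonzero-slotOf false false = refl

  #nonmaximal #maximal : (Fin n → Bool) → ℕ
  #nonmaximal I = count n (λ k → I k ∧ not (maximal K W P I k))
  #maximal    I = count n (maximal K W P I)

  wPw-on-fibre : ∀ I u → (∀ k → I k ≡ idealOf K W P u k) →
    wPw K W P u ≡ #nonmaximal I * M + ∑[ k < n ] slotWeight (slot I k) (u k)
  wPw-on-fibre I u I≗ = begin
    sumFin n (λ k → if maximalOf K W P u k then w (u k) else 0) + card n (λ k → idealOf K W P u k ∧ not (maximalOf K W P u k)) * M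
      ≡⟨ cong₂ (λ x y → x + y * M) (sumFin≡∑ n _) (sumFin≡∑ n _) ⟩
    ∑[ k < n ] (if maximalOf K W P u k then w (u k) else 0) + count n (λ k → idealOf K W P u k ∧ not (maximalOf K W P u k)) * M
      ≡⟨ cong₂ (λ x y → x + y * M)
           (sum-cong-≗ {n} (λ k → trans (cong (λ b → if b then w (u k) else 0) (sym (same-maximal k))) (sym (slotWeight-slotOf _ (I k) (u k)))))
           (sum-cong-≗ {n} (λ k → cong 𝟙 (cong₂ (λ a b → a ∧ not b) (sym (I≗ k)) (sym (same-maximal k))))) ⟩
    ∑[ k < n ] slotWeight (slot I k) (u k) + #nonmaximal I * M
      ≡⟨ +-comm _ (#nonmaximal I * M) ⟩
    #nonmaximal I * M + ∑[ k < n ] slotWeight (slot I k) (u k) ∎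
    where
    same-maximal : ∀ k → maximal K W P I k ≡ maximalOf K W P u k
    same-maximal k = T⇔T⇒≡ (mk⇔
      (λ t → from (T-maximal (idealOf K W P u) k) (IsMaximal-cong I≗ k (to (T-maximal I k) t)))
      (λ t → from (T-maximal I k) (IsMaximal-cong (sym ∘ I≗) k (to (T-maximal (idealOf K W P u) k) t))))

  fibreCount : ℕ → (Fin n → Bool) → ℕ
  fibreCount r I = if isIdeal K W P I then q ^ #nonmaximal I * shift (#nonmaximal I * M) (coeffPow D M (#maximal I)) r else 0

  fibre : ∀ I r → sumFun (allFin q) n (λ u → if sameSet n I (idealOf K W P u) then 𝟙 (wPw K W P u ≡ᵇ r) else 0) ≡ fibreCount r I
  fibre I r = by-ideal (isIdeal K W P I) refl
    where
    a = #nonmaximal I * M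
    weightOn : (Fin n → Fin q) → ℕ
    weightOn u = ∑[ k < n ] slotWeight (slot I k) (u k)

    by-ideal : ∀ b → isIdeal K W P I ≡ b →
      sumFun (allFin q) n (λ u → if sameSet n I (idealOf K W P u) then 𝟙 (wPw K W P u ≡ᵇ r) else 0)
        ≡ (if b then q ^ #nonmaximal I * shift a (coeffPow D M (#maximal I)) r else 0)
    by-ideal false not-ideal = sumFun-zero (allFin q) n (λ u → empty u (sameSet n I (idealOf K W P u)) refl)
      where
      empty : ∀ u b → sameSet n I (idealOf K W P u) ≡ b → (if b then 𝟙 (wPw K W P u ≡ᵇ r) else 0) ≡ 0
      empty u false _ = refl
      empty u true  same = ⊥-elim (subst T not-ideal (from (T-isIdeal I) λ i j Ii j≼i →
        let I≗ = to (T-sameSet n I _) (from T-≡ same) in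
        subst T (sym (I≗ j)) (idealOf-downClosed u i j (subst T (I≗ i) Ii) j≼i)))
    by-ideal true ideal = begin
      sumFun (allFin q) n (λ u → if sameSet n I (idealOf K W P u) then 𝟙 (wPw K W P u ≡ᵇ r) else 0)
        ≡⟨ sumFun-cong (allFin q) n (λ u → trans
             (cong (λ b → if b then 𝟙 (wPw K W P u ≡ᵇ r) else 0) (sameSet≡fits I I-down u))
             (on-fibre u (fits n (slot I) u) refl)) ⟩
      sumFun (allFin q) n (λ u → shift a (λ R → if fits n (slot I) u then 𝟙 (weightOn u ≡ᵇ R) else 0) r)
        ≡⟨ commute-shift (sumFun (allFin q) n) (sumFun-zero (allFin q) n (λ _ → refl)) a
             (λ u R → if fits n (slot I) u then 𝟙 (weightOn u ≡ᵇ R) else 0) r ⟩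
      shift a (λ R → sumFun (allFin q) n (λ u → if fits n (slot I) u then 𝟙 (weightOn u ≡ᵇ R) else 0)) r
        ≡⟨ shift-cong a (count-by-slots n (slot I)) r ⟩
      shift a (λ R → q ^ count n (isFree ∘ slot I) * coeffPow D M (count n (isNonzero ∘ slot I)) R) r
        ≡⟨ shift-*ˡ a (q ^ count n (isFree ∘ slot I)) (coeffPow D M (count n (isNonzero ∘ slot I))) r ⟩
      q ^ count n (isFree ∘ slot I) * shift a (coeffPow D M (count n (isNonzero ∘ slot I))) r
        ≡⟨ cong₂ (λ f m → q ^ f * shift a (coeffPow D M m) r)
             (sum-cong-≗ {n} (λ k → cong 𝟙 (isFree-slotOf (maximal K W P I k) (I k))))
             (sum-cong-≗ {n} (λ k → cong 𝟙 (isNonzero-slotOf (maximal K W P I k) (I k)))) ⟩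
      q ^ #nonmaximal I * shift a (coeffPow D M (#maximal I)) r ∎
      where
      I-down : IsDownClosed I
      I-down = to (T-isIdeal I) (from T-≡ ideal)
      on-fibre : ∀ u b → fits n (slot I) u ≡ b →
        (if b then 𝟙 (wPw K W P u ≡ᵇ r) else 0) ≡ shift a (λ R → if b then 𝟙 (weightOn u ≡ᵇ R) else 0) r
      on-fibre u false _ = sym (shift-zero a r)
      on-fibre u true  fits-u = trans
        (cong (λ x → 𝟙 (x ≡ᵇ r)) (wPw-on-fibre I u (fits⇒sameSet I I-down u (to (T-allFinB n) (from T-≡ fits-u)))))
        (𝟙-+≡shift a (weightOn u) r)

  rhsTerm : ℕ → ℕ → ℕ → ℕ
  rhsTerm r i j = q ^ (i ∸ j) * shift ((i ∸ j) * M) (coeffPow D M (suc j)) r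

  module _ (r : ℕ) (1≤r : 1 ≤ r) where

    by-sizes : ∀ cI cM cF → cF + cM ≡ cI → cI ≤ n → (1 ≤ cI → 1 ≤ cM) →
      ∑< n (λ i → ∑< (suc i) (λ j → 𝟙 ((cI ≡ᵇ suc i) ∧ (cM ≡ᵇ suc j)) * rhsTerm r i j))
        ≡ q ^ cF * shift (cF * M) (coeffPow D M cM) r
    by-sizes zero zero zero _ _ _ = begin
      ∑< n (λ i → ∑< (suc i) (λ j → 0)) ≡⟨ ∑-zero n (λ i → ∑-zero (suc (toℕ i)) (λ _ → refl)) ⟩
      0                                 ≡⟨ cong 𝟙 (¬T⇒≡false (>⇒≢ 1≤r ∘ ≡ᵇ⇒≡ r 0)) ⟨
      𝟙 (r ≡ᵇ 0)                        ≡⟨ trans (+-identityʳ (coeffPow D M 0 r)) (coeffPow-zero D M r) ⟨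
      1 * coeffPow D M 0 r              ∎
    by-sizes (suc i₀) zero cF _ _ pos = ⊥-elim (1+n≰n (pos (s≤s z≤n)))
    by-sizes (suc i₀) (suc j₀) cF cF+cM≡cI cI≤n _ = begin
      ∑< n (λ i → ∑< (suc i) (λ j → 𝟙 ((i₀ ≡ᵇ i) ∧ (j₀ ≡ᵇ j)) * rhsTerm r i j))
        ≡⟨ ∑<-δ₂ n i₀ j₀ (rhsTerm r) cI≤n (≤-pred (subst (suc j₀ ≤_) cF+cM≡cI (m≤n+m (suc j₀) cF))) ⟩
      rhsTerm r i₀ j₀
        ≡⟨ cong (λ c → q ^ c * shift (c * M) (coeffPow D M (suc j₀)) r) (trans (cong (_∸ suc j₀) (sym cF+cM≡cI)) (m+n∸n≡m cF (suc j₀))) ⟩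
      q ^ cF * shift (cF * M) (coeffPow D M (suc j₀)) r ∎

    by-ideal-size : ∀ I →
      ∑< n (λ i → ∑< (suc i) (λ j → 𝟙 (isIdeal K W P I ∧ (card n I ≡ᵇ suc i) ∧ (card n (maximal K W P I) ≡ᵇ suc j)) * rhsTerm r i j))
        ≡ fibreCount r I
    by-ideal-size I = by-ideal (isIdeal K W P I) refl
      where
      by-ideal : ∀ b → isIdeal K W P I ≡ b →
        ∑< n (λ i → ∑< (suc i) (λ j → 𝟙 (b ∧ (card n I ≡ᵇ suc i) ∧ (card n (maximal K W P I) ≡ᵇ suc j)) * rhsTerm r i j))
          ≡ (if b then q ^ #nonmaximal I * shift (#nonmaximal I * M) (coeffPow D M (#maximal I)) r else 0)
      by-ideal false _ = ∑-zero n (λ i → ∑-zero (suc (toℕ i)) (λ _ → refl))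
      by-ideal true  _ rewrite sumFin≡∑ n (𝟙 ∘ I) | sumFin≡∑ n (𝟙 ∘ maximal K W P I) =
        by-sizes (count n I) (#maximal I) (#nonmaximal I)
          (count-split n I (maximal K W P I) (λ k max-k → proj₁ (to (T-maximal I k) max-k)))
          (count≤n n I)
          (λ 1≤|I| → let (k , Ik) = to (count-pos n I) 1≤|I| ; (m , max-m , _) = maximal-above I k Ik in
                      from (count-pos n (maximal K W P I)) (m , from (T-maximal I m) max-m))

    Acard≡∑-fibres : Acard K W P r ≡ sumFun bools n (fibreCount r)
    Acard≡∑-fibres = begin
      sumFun (allFin q) n (λ u → 𝟙 (wPw K W P u ≡ᵇ r))
        ≡⟨ sumFun-cong (allFin q) n (λ u → sumFun-sameSet-δ n (idealOf K W P u) (𝟙 (wPw K W P u ≡ᵇ r))) ⟨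
      sumFun (allFin q) n (λ u → sumFun bools n (λ I → in-fibre I u))
        ≡⟨ sumFun-comm (allFin q) n bools n (λ u I → in-fibre I u) ⟩
      sumFun bools n (λ I → sumFun (allFin q) n (in-fibre I))
        ≡⟨ sumFun-cong bools n (λ I → fibre I r) ⟩
      sumFun bools n (fibreCount r) ∎
      where
      in-fibre : (Fin n → Bool) → (Fin n → Fin q) → ℕ
      in-fibre I u = if sameSet n I (idealOf K W P u) then 𝟙 (wPw K W P u ≡ᵇ r) else 0

    ∑-fibres≡RHS : sumFun bools n (fibreCount r) ≡ RHS K W P r
    ∑-fibres≡RHS = begin
      sumFun bools n (fibreCount r)
        ≡⟨ sumFun-cong bools n by-ideal-size ⟨
      sumFun bools n (λ I → ∑< n (λ i → ∑< (suc i) (λ j → 𝟙 (selected I i j) * rhsTerm r i j)))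
        ≡⟨ ∑-sumFun bools n n (λ i I → ∑< (suc (toℕ i)) (λ j → 𝟙 (selected I (toℕ i) j) * rhsTerm r (toℕ i) j)) ⟨
      ∑< n (λ i → sumFun bools n (λ I → ∑< (suc i) (λ j → 𝟙 (selected I i j) * rhsTerm r i j)))
        ≡⟨ sum-cong-≗ {n} (λ i → sym (∑-sumFun bools (suc (toℕ i)) n
             (λ j I → 𝟙 (selected I (toℕ i) (toℕ j)) * rhsTerm r (toℕ i) (toℕ j)))) ⟩
      ∑< n (λ i → ∑< (suc i) (λ j → sumFun bools n (λ I → 𝟙 (selected I i j) * rhsTerm r i j)))
        ≡⟨ ∑<-cong n (λ i i<n → ∑<-cong (suc i) (λ j j≤i → trans
             (sumFun-*ʳ bools n (λ I → 𝟙 (selected I i j)) (rhsTerm r i j))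
             (cong (idealCount K W P (suc i) (suc j) *_) (sym (sumPRT≡shift-coeffPow D (q ^ (i ∸ j)) n M (i ∸ j) r (suc j)
               (s≤s z≤n) (subst (_≤ n) (cong suc (sym (m+[n∸m]≡n (≤-pred j≤i)))) i<n)))))) ⟩
      ∑< n (λ i → ∑< (suc i) (λ j → idealCount K W P (suc i) (suc j) * rhsSummand (suc i) (suc j)))
        ≡⟨ sum-cong-≗ {n} (λ i → sumRange≡∑< (suc (toℕ i)) (λ j → idealCount K W P (suc (toℕ i)) j * rhsSummand (suc (toℕ i)) j)) ⟨
      ∑< n (λ i → sumRange 1 (suc i) (λ j → idealCount K W P (suc i) j * rhsSummand (suc i) j))
        ≡⟨ sumRange≡∑< n (λ i → sumRange 1 i (λ j → idealCount K W P i j * rhsSummand i j)) ⟨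
      RHS K W P r ∎
      where
      selected : (Fin n → Bool) → ℕ → ℕ → Bool
      selected I i j = isIdeal K W P I ∧ (card n I ≡ᵇ suc i) ∧ (card n (maximal K W P I) ≡ᵇ suc j)
      rhsSummand : ℕ → ℕ → ℕ
      rhsSummand i j = sumPRT n M (i ∸ j) r j (λ b → q ^ (i ∸ j) * runProd D j 0 (runs (toList j b)))

corollary3p2 : {q n : ℕ} (K : FiniteField q) (W : Weight K) (P : Poset n)
    → (r : ℕ) → 1 ≤ r → r ≤ n * Mw K W P
    → Acard K W P r ≡ RHS K W P r
corollary3p2 K W P r 1≤r _ = trans (Acard≡∑-fibres K W P r 1≤r) (∑-fibres≡RHS K W P r 1≤r)
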